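{- Let $n$ be a positive integer. Then: (a) $\mathrm{num}_{\mathcal B}(2n+1,x)=\mathrm{num}_{\mathcal B}(2n,x)$. (b) $d(n)=\sum_{j\geq1}2^j\lfloor n/2^j\rfloor$. (c) $d(n)$ is even, $2^{\lfloor\log_2 n\rfloor}\lfloor\log_2 n\rfloor\le d(n)\le n\lfloor\log_2 n\rfloor$, and more precisely $d(n)=n\lfloor\log_2 n\rfloor-\sum_{j=\mathrm{val}_2(n)+1}^{\lfloor\log_2 n\rfloor}r_j$, where $r_j$ is the remainder of $n$ upon division by $2^j$. (d) $b_k(n)>0$ for all $k=0,\dots,d(n)$. (e) $\mathrm{num}_{\mathcal B}(n,x)$ and $\mathrm{den}_{\mathcal B}(n,x)$ are palindromic. (f) $b_0(n)=B(n)$, $b_1(n)=\sum_{\lambda\in\mathcal B(n)}(n-m_\lambda(1))$, and $b_2(n)=\sum_{\lambda\in\mathcal B(n)}\Big(\binom{n-m_\lambda(1)}{2}+\lfloor n/2\rfloor-m_\lambda(2)\Big)$. (g) $\mathrm{num}_{\mathcal B}(n,-1)=2^{\mathrm{val}_2(n!)}$. (h) If $n>1$, then $(1+x+x^2)\mid\mathrm{num}_{\mathcal B}(n,x)$.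
   Context: $\mathcal B(n)$ is the set of binary partitions of $n$ (partitions all of whose parts are powers of $2$), $B(n)=|\mathcal B(n)|$, and $m_\lambda(i)$ is the number of parts of $\lambda$ equal to $i$. For $\lambda\in\mathcal B(n)$ let $h_{\mathcal B,\lambda}(x)=\prod_{i=0}^{\lfloor\log_2 n\rfloor}(1+x^{2^i})^{\lfloor n/2^i\rfloor-m_\lambda(2^i)}$. Define $\mathrm{num}_{\mathcal B}(n,x)=\sum_{\lambda\in\mathcal B(n)}h_{\mathcal B,\lambda}(x)=\sum_{k=0}^{d(n)}b_k(n)x^k$ with $d(n)=\deg\mathrm{num}_{\mathcal B}(n,x)$, and $\mathrm{den}_{\mathcal B}(n,x)=\prod_{i=0}^{\lfloor\log_2 n\rfloor}(1+x^{2^i})^{\lfloor n/2^i\rfloor}$. $\mathrm{val}_2$ is the $2$-adic valuation. A polynomial of degree $D$ is palindromic if the coefficients of $x^k$ and $x^{D-k}$ agree for all $k$. -}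

module Defs where

open import Data.Nat as ℕ using (ℕ; zero; suc; _≟_; _∸_)
open import Data.Nat.Properties using (m^n≢0)
open import Data.Nat.DivMod using (_/_; _%_)
open import Data.Nat.Logarithm using (⌊log₂_⌋)
open import Data.Integer as ℤ using (ℤ; +_)
open import Data.Nat.ListAction using (sum)
open import Data.List using (List; []; _∷_; map; filter; concatMap; upTo; length; foldr; replicate; _++_)
open import Data.Bool using (if_then_else_)
open import Relation.Nullary.Decidable using (⌊_⌋)
open import Relation.Binary.PropositionalEquality using (_≡_)
open import Data.Product using (Σ)

_/2^_ : ℕ → ℕ → ℕ
n /2^ i = _/_ n (2 ℕ.^ i) {{m^n≢0 2 i}}

_%2^_ : ℕ → ℕ → ℕ
n %2^ i = _%_ n (2 ℕ.^ i) {{m^n≢0 2 i}}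

L : ℕ → ℕ
L n = ⌊log₂ n ⌋

-- Σ_{j=a}^{b} f j  (empty if b < a)
sumRange : ℕ → ℕ → (ℕ → ℕ) → ℕ
sumRange a b f = sum (map (λ i → f (a ℕ.+ i)) (upTo (suc b ∸ a)))

-- 2-adic valuation (for m > 0): number of times 2 divides m.
-- The fuel argument (taken equal to m) is always sufficient.
val2-go : ℕ → ℕ → ℕ
val2-go zero    m = 0
val2-go (suc f) m =
  if ⌊ m ≟ 0 ⌋ then 0
  else if ⌊ m % 2 ≟ 0 ⌋ then suc (val2-go f (m / 2)) else 0

val₂ : ℕ → ℕ
val₂ m = val2-go m m

-- Binary partitions, represented by their multiplicity vectors:
-- λ ∈ 𝓑(n) is the list [m_λ(2^0), m_λ(2^1), …, m_λ(2^L(n))]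
-- with Σ_i m_λ(2^i)·2^i = n.  (Parts larger than 2^L(n) cannot occur.)

weightFrom : ℕ → List ℕ → ℕ
weightFrom i []       = 0
weightFrom i (m ∷ ms) = m ℕ.* 2 ℕ.^ i ℕ.+ weightFrom (suc i) ms

boxes : List ℕ → List (List ℕ)
boxes []       = [] ∷ []
boxes (b ∷ bs) = concatMap (λ m → map (m ∷_) (boxes bs)) (upTo (suc b))

-- 𝓑(n): every multiplicity vector of total weight n
-- (each multiplicity m(2^i) is necessarily ≤ ⌊n/2^i⌋)
𝓑 : ℕ → List (List ℕ)
𝓑 n = filter (λ ms → weightFrom 0 ms ≟ n)
             (boxes (map (λ i → n /2^ i) (upTo (suc (L n)))))

B : ℕ → ℕ
B n = length (𝓑 n)

mult : List ℕ → ℕ → ℕ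
mult []       i       = 0
mult (m ∷ ms) zero    = m
mult (m ∷ ms) (suc i) = mult ms i

-- Polynomials with integer coefficients, as coefficient lists
-- [a_0, a_1, …]  (trailing zeros allowed).

Poly : Set
Poly = List ℤ

coeff : Poly → ℕ → ℤ
coeff []       k       = + 0
coeff (a ∷ p)  zero    = a
coeff (a ∷ p)  (suc k) = coeff p k

_+ₚ_ : Poly → Poly → Poly
[]      +ₚ q       = q
(a ∷ p) +ₚ []      = a ∷ p
(a ∷ p) +ₚ (b ∷ q) = (a ℤ.+ b) ∷ (p +ₚ q)

_*ₚ_ : Poly → Poly → Poly
[]      *ₚ q = []
(a ∷ p) *ₚ q = map (a ℤ.*_) q +ₚ (+ 0 ∷ (p *ₚ q))

oneₚ : Poly
oneₚ = + 1 ∷ []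

_^ₚ_ : Poly → ℕ → Poly
p ^ₚ zero  = oneₚ
p ^ₚ suc k = p *ₚ (p ^ₚ k)

monoₚ : ℕ → Poly
monoₚ e = replicate e (+ 0) ++ (+ 1 ∷ [])

1+x^ : ℕ → Poly
1+x^ e = oneₚ +ₚ monoₚ e

trimLen : Poly → ℕ
trimLen []      = 0
trimLen (a ∷ p) with trimLen p
... | suc k = suc (suc k)
... | zero  = if ⌊ a ℤ.≟ + 0 ⌋ then 0 else 1

-- degree (index of the highest nonzero coefficient; 0 for the zero polynomial)
deg : Poly → ℕ
deg p = trimLen p ∸ 1

Palindromic : Poly → Set
Palindromic p = ∀ k → k ℕ.≤ deg p → coeff p k ≡ coeff p (deg p ∸ k)

eval : Poly → ℤ → ℤ
eval p c = foldr (λ a acc → a ℤ.+ c ℤ.* acc) (+ 0) p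

-- divisibility in ℤ[x] (equality of polynomials is coefficientwise)
_∣ₚ_ : Poly → Poly → Set
f ∣ₚ p = Σ Poly (λ q → ∀ k → coeff p k ≡ coeff (f *ₚ q) k)

prodL : ℕ → (ℕ → ℕ) → Poly
prodL n e = foldr (λ i acc → (1+x^ (2 ℕ.^ i) ^ₚ e i) *ₚ acc) oneₚ (upTo (suc (L n)))

h𝓑 : ℕ → List ℕ → Poly
h𝓑 n λ' = prodL n (λ i → (n /2^ i) ∸ mult λ' i)

num𝓑 : ℕ → Poly
num𝓑 n = foldr (λ λ' acc → h𝓑 n λ' +ₚ acc) [] (𝓑 n)

den𝓑 : ℕ → Poly
den𝓑 n = prodL n (λ i → n /2^ i)

d : ℕ → ℕ
d n = deg (num𝓑 n)

b : ℕ → ℕ → ℤ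
b n k = coeff (num𝓑 n) k

{-# OPTIONS --safe #-}
-- Each h_{𝓑,λ} is a product of binomials 1 + x^(2^i), of degree Σᵢ 2^i (⌊n/2^i⌋ - m_λ(2^i)), which equals
-- d(n) = Σᵢ 2^i ⌊n/2^i⌋ - n for every λ ∈ 𝓑(n).  The coefficients of such a product are nonnegative and
-- palindromic about its degree, so the same holds for their sum; all its coefficients up to d(n) are
-- positive because this is already true for λ = (n mod 2)·1 + ⌊n/2⌋·2, and b₀, b₁, b₂ only see the
-- factors 1 + x and 1 + x².  Sums over 𝓑(n) are split according to the number m of parts 1, the other
-- parts halved forming a partition of (n - m)/2.  This gives the bijection 𝓑(2n) → 𝓑(2n+1) behind (a),
-- leaves only λ = 1ⁿ at x = -1 in (g), and at a primitive cube root of unity ω, where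
-- 1 + ω^(2^t) = -ω^(2^(t+1)), makes the terms cancel in pairs, which gives (h).
module Submission where

open import Defs
open import Data.Nat using (ℕ; _+_; _*_; _^_; _∸_; _≤_; _<_; _/_)
open import Data.Nat.Divisibility using (_∣_)
open import Data.Nat.Combinatorics using (_C_)
open import Data.Nat.ListAction using (sum)
open import Data.Nat.Base using (_!)
open import Data.Integer as ℤ using (ℤ; +_; -[1+_])
open import Data.List using (List; []; _∷_; map)
open import Data.Product using (_×_)
open import Relation.Binary.PropositionalEquality using (_≡_)

open import Algebra.Bundles using (CommutativeSemiring)
open import Data.Bool using (Bool; true; false; if_then_else_)
open import Data.Empty using (⊥-elim)
open import Data.Nat using (zero; suc; z≤n; s≤s; s≤s⁻¹; _≟_; _≤?_; _%_; ⌊_/2⌋; >-nonZero; ≢-nonZero⁻¹)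
open import Data.Nat.Combinatorics using (nCk+nC[k+1]≡[n+1]C[k+1]; nC1≡n)
open import Data.Nat.DivMod
open import Data.Nat.Divisibility using (divides; ∣m∣n⇒∣m+n; n∣m⇒m%n≡0; ∣-trans; ∣⇒≤)
open import Data.Nat.Induction using (<-rec)
open import Data.Nat.Logarithm using (⌊log₂⌋-mono-≤; ⌊log₂⌊n/2⌋⌋≡⌊log₂n⌋∸1)
open import Data.Nat.Properties
open import Data.Nat.Tactic.RingSolver using () renaming (solve-∀ to ℕ-solve-∀)
import Data.Integer.Properties as ℤP
open import Data.Integer.Tactic.RingSolver using (solve-∀)
open import Data.List using (foldr; filter; concatMap; concat; upTo; applyUpTo; replicate; length; _++_; [_])
open import Data.List.Properties using (length-map; length-upTo; map-upTo; map-cong; map-cong-local; map-∘; upTo-∷ʳ)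
open import Data.List.Membership.Propositional using (_∈_)
open import Data.List.Membership.Propositional.Properties
  using (∈-map⁺; ∈-map⁻; ∈-concatMap⁺; ∈-concatMap⁻; ∈-upTo⁺; ∈-upTo⁻; ∈-filter⁺; ∈-filter⁻)
open import Data.List.Relation.Binary.Pointwise using (Pointwise; []; _∷_; Pointwise-length)
open import Data.List.Relation.Unary.All using (All; []; _∷_)
open import Data.List.Relation.Unary.All.Properties using (applyUpTo⁺₁; applyUpTo⁺₂)
open import Data.List.Relation.Unary.Any using (Any; here; there)
import Data.List.Relation.Unary.Any as Any
open import Data.Product using (∃-syntax; _,_; proj₁; proj₂)
open import Data.Sum using (_⊎_; inj₁; inj₂)
open import Function using (_∘_; id)
open import Level using (0ℓ)
open import Relation.Binary.PropositionalEquality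
  using (refl; sym; trans; cong; cong₂; subst; subst₂; _≗_; _≢_; isEquivalence; module ≡-Reasoning)
open import Relation.Nullary using (Dec; yes; no; does)
open import Relation.Nullary.Decidable using (dec-true; dec-false)

-- Coefficientwise arithmetic of polynomials

shift : (ℕ → ℤ) → ℕ → ℤ
shift c zero    = + 0
shift c (suc k) = c k

shift-cong : ∀ {c c′} → c ≗ c′ → shift c ≗ shift c′
shift-cong c≗c′ zero    = refl
shift-cong c≗c′ (suc k) = c≗c′ k

shift-+ : ∀ c c′ k → shift (λ j → c j ℤ.+ c′ j) k ≡ shift c k ℤ.+ shift c′ k
shift-+ c c′ zero    = refl
shift-+ c c′ (suc k) = refl

shift-scale : ∀ a c k → shift (λ j → a ℤ.* c j) k ≡ a ℤ.* shift c k
shift-scale a c zero    = sym (ℤP.*-zeroʳ a)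
shift-scale a c (suc k) = refl

shiftBy : ℕ → (ℕ → ℤ) → ℕ → ℤ
shiftBy zero    c = c
shiftBy (suc m) c = shift (shiftBy m c)

shiftBy-cong : ∀ m {c c′} → c ≗ c′ → shiftBy m c ≗ shiftBy m c′
shiftBy-cong zero    c≗c′ = c≗c′
shiftBy-cong (suc m) c≗c′ = shift-cong (shiftBy-cong m c≗c′)

shiftBy-below : ∀ m c k → k < m → shiftBy m c k ≡ + 0
shiftBy-below (suc m) c zero    _         = refl
shiftBy-below (suc m) c (suc k) (s≤s k<m) = shiftBy-below m c k k<m

shiftBy-+ : ∀ m c k → shiftBy m c (m + k) ≡ c k
shiftBy-+ zero    c k = refl
shiftBy-+ (suc m) c k = shiftBy-+ m c k

shiftBy-≥ : ∀ m c {k} → m ≤ k → shiftBy m c k ≡ c (k ∸ m)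
shiftBy-≥ m c m≤k = trans (cong (shiftBy m c) (sym (m+[n∸m]≡n m≤k))) (shiftBy-+ m c _)

shiftBy-nonneg : ∀ {c} → (∀ k → + 0 ℤ.≤ c k) → ∀ m k → + 0 ℤ.≤ shiftBy m c k
shiftBy-nonneg c≥0 zero    k       = c≥0 k
shiftBy-nonneg c≥0 (suc m) zero    = ℤP.≤-refl
shiftBy-nonneg c≥0 (suc m) (suc k) = shiftBy-nonneg c≥0 m k

coeff-+ₚ : ∀ p q k → coeff (p +ₚ q) k ≡ coeff p k ℤ.+ coeff q k
coeff-+ₚ []      q       k       = sym (ℤP.+-identityˡ _)
coeff-+ₚ (a ∷ p) []      k       = sym (ℤP.+-identityʳ _)
coeff-+ₚ (a ∷ p) (b ∷ q) zero    = refl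
coeff-+ₚ (a ∷ p) (b ∷ q) (suc k) = coeff-+ₚ p q k

coeff-scale : ∀ a q k → coeff (map (a ℤ.*_) q) k ≡ a ℤ.* coeff q k
coeff-scale a []      k       = sym (ℤP.*-zeroʳ a)
coeff-scale a (b ∷ q) zero    = refl
coeff-scale a (b ∷ q) (suc k) = coeff-scale a q k

coeff-∷-*ₚ : ∀ a p q k → coeff ((a ∷ p) *ₚ q) k ≡ a ℤ.* coeff q k ℤ.+ shift (coeff (p *ₚ q)) k
coeff-∷-*ₚ a p q k =
  trans (coeff-+ₚ (map (a ℤ.*_) q) (+ 0 ∷ p *ₚ q) k) (cong₂ ℤ._+_ (coeff-scale a q k) (coeff-0∷ k))
  where
  coeff-0∷ : ∀ k → coeff (+ 0 ∷ p *ₚ q) k ≡ shift (coeff (p *ₚ q)) k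
  coeff-0∷ zero    = refl
  coeff-0∷ (suc k) = refl

coeff-+ₚ-*ₚ : ∀ p q r k → coeff ((p +ₚ q) *ₚ r) k ≡ coeff (p *ₚ r) k ℤ.+ coeff (q *ₚ r) k
coeff-+ₚ-*ₚ []      q       r k = sym (ℤP.+-identityˡ _)
coeff-+ₚ-*ₚ (a ∷ p) []      r k = sym (ℤP.+-identityʳ _)
coeff-+ₚ-*ₚ (a ∷ p) (b ∷ q) r k = begin
  coeff (((a ℤ.+ b) ∷ (p +ₚ q)) *ₚ r) k
    ≡⟨ coeff-∷-*ₚ (a ℤ.+ b) (p +ₚ q) r k ⟩
  (a ℤ.+ b) ℤ.* coeff r k ℤ.+ shift (coeff ((p +ₚ q) *ₚ r)) k
    ≡⟨ cong (ℤ._+_ ((a ℤ.+ b) ℤ.* coeff r k))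
            (trans (shift-cong (coeff-+ₚ-*ₚ p q r) k) (shift-+ (coeff (p *ₚ r)) (coeff (q *ₚ r)) k)) ⟩
  (a ℤ.+ b) ℤ.* coeff r k ℤ.+ (shift (coeff (p *ₚ r)) k ℤ.+ shift (coeff (q *ₚ r)) k)
    ≡⟨ regroup a b (coeff r k) _ _ ⟩
  (a ℤ.* coeff r k ℤ.+ shift (coeff (p *ₚ r)) k) ℤ.+ (b ℤ.* coeff r k ℤ.+ shift (coeff (q *ₚ r)) k)
    ≡⟨ sym (cong₂ ℤ._+_ (coeff-∷-*ₚ a p r k) (coeff-∷-*ₚ b q r k)) ⟩
  coeff ((a ∷ p) *ₚ r) k ℤ.+ coeff ((b ∷ q) *ₚ r) k ∎
  where
  open ≡-Reasoning
  regroup : ∀ a b x s t → (a ℤ.+ b) ℤ.* x ℤ.+ (s ℤ.+ t) ≡ (a ℤ.* x ℤ.+ s) ℤ.+ (b ℤ.* x ℤ.+ t)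
  regroup = solve-∀

coeff-scale-*ₚ : ∀ a q r k → coeff (map (a ℤ.*_) q *ₚ r) k ≡ a ℤ.* coeff (q *ₚ r) k
coeff-scale-*ₚ a []      r k = sym (ℤP.*-zeroʳ a)
coeff-scale-*ₚ a (b ∷ q) r k = begin
  coeff ((a ℤ.* b ∷ map (a ℤ.*_) q) *ₚ r) k
    ≡⟨ coeff-∷-*ₚ (a ℤ.* b) (map (a ℤ.*_) q) r k ⟩
  (a ℤ.* b) ℤ.* coeff r k ℤ.+ shift (coeff (map (a ℤ.*_) q *ₚ r)) k
    ≡⟨ cong (ℤ._+_ ((a ℤ.* b) ℤ.* coeff r k))
            (trans (shift-cong (coeff-scale-*ₚ a q r) k) (shift-scale a (coeff (q *ₚ r)) k)) ⟩
  (a ℤ.* b) ℤ.* coeff r k ℤ.+ a ℤ.* shift (coeff (q *ₚ r)) k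
    ≡⟨ factor a b (coeff r k) _ ⟩
  a ℤ.* (b ℤ.* coeff r k ℤ.+ shift (coeff (q *ₚ r)) k)
    ≡⟨ cong (a ℤ.*_) (sym (coeff-∷-*ₚ b q r k)) ⟩
  a ℤ.* coeff ((b ∷ q) *ₚ r) k ∎
  where
  open ≡-Reasoning
  factor : ∀ a b x s → (a ℤ.* b) ℤ.* x ℤ.+ a ℤ.* s ≡ a ℤ.* (b ℤ.* x ℤ.+ s)
  factor = solve-∀

*ₚ-assoc : ∀ p q r → coeff ((p *ₚ q) *ₚ r) ≗ coeff (p *ₚ (q *ₚ r))
*ₚ-assoc []      q r k = refl
*ₚ-assoc (a ∷ p) q r k = begin
  coeff ((map (a ℤ.*_) q +ₚ (+ 0 ∷ p *ₚ q)) *ₚ r) k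
    ≡⟨ coeff-+ₚ-*ₚ (map (a ℤ.*_) q) (+ 0 ∷ p *ₚ q) r k ⟩
  coeff (map (a ℤ.*_) q *ₚ r) k ℤ.+ coeff ((+ 0 ∷ p *ₚ q) *ₚ r) k
    ≡⟨ cong₂ ℤ._+_ (coeff-scale-*ₚ a q r k) (trans (coeff-∷-*ₚ (+ 0) (p *ₚ q) r k) (ℤP.+-identityˡ _)) ⟩
  a ℤ.* coeff (q *ₚ r) k ℤ.+ shift (coeff ((p *ₚ q) *ₚ r)) k
    ≡⟨ cong (ℤ._+_ (a ℤ.* coeff (q *ₚ r) k)) (shift-cong (*ₚ-assoc p q r) k) ⟩
  a ℤ.* coeff (q *ₚ r) k ℤ.+ shift (coeff (p *ₚ (q *ₚ r))) k
    ≡⟨ sym (coeff-∷-*ₚ a p (q *ₚ r) k) ⟩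
  coeff ((a ∷ p) *ₚ (q *ₚ r)) k ∎
  where open ≡-Reasoning

coeff-oneₚ-*ₚ : ∀ q → coeff (oneₚ *ₚ q) ≗ coeff q
coeff-oneₚ-*ₚ q k =
  trans (coeff-∷-*ₚ (+ 1) [] q k) (trans (cong₂ ℤ._+_ (ℤP.*-identityˡ (coeff q k)) (shift-[] k)) (ℤP.+-identityʳ _))
  where
  shift-[] : ∀ k → shift (coeff []) k ≡ + 0
  shift-[] zero    = refl
  shift-[] (suc k) = refl

coeff-x^-*ₚ : ∀ m q → coeff (monoₚ m *ₚ q) ≗ shiftBy m (coeff q)
coeff-x^-*ₚ zero    q k = coeff-oneₚ-*ₚ q k
coeff-x^-*ₚ (suc m) q k =
  trans (coeff-∷-*ₚ (+ 0) (monoₚ m) q k) (trans (ℤP.+-identityˡ _) (shift-cong (coeff-x^-*ₚ m q) k))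

mul1+x^ : ℕ → (ℕ → ℤ) → ℕ → ℤ
mul1+x^ m c k = c k ℤ.+ shiftBy m c k

mulPow1+x^ : ℕ → ℕ → (ℕ → ℤ) → ℕ → ℤ
mulPow1+x^ m zero    c = c
mulPow1+x^ m (suc a) c = mul1+x^ m (mulPow1+x^ m a c)

mul1+x^-cong : ∀ m {c c′} → c ≗ c′ → mul1+x^ m c ≗ mul1+x^ m c′
mul1+x^-cong m c≗c′ k = cong₂ ℤ._+_ (c≗c′ k) (shiftBy-cong m c≗c′ k)

coeff-1+x^-*ₚ : ∀ m q → coeff (1+x^ m *ₚ q) ≗ mul1+x^ m (coeff q)
coeff-1+x^-*ₚ m q k =
  trans (coeff-+ₚ-*ₚ oneₚ (monoₚ m) q k) (cong₂ ℤ._+_ (coeff-oneₚ-*ₚ q k) (coeff-x^-*ₚ m q k))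

coeff-1+x^^-*ₚ : ∀ m a q → coeff ((1+x^ m ^ₚ a) *ₚ q) ≗ mulPow1+x^ m a (coeff q)
coeff-1+x^^-*ₚ m zero    q k = coeff-oneₚ-*ₚ q k
coeff-1+x^^-*ₚ m (suc a) q k =
  trans (*ₚ-assoc (1+x^ m) (1+x^ m ^ₚ a) q k)
        (trans (coeff-1+x^-*ₚ m ((1+x^ m ^ₚ a) *ₚ q) k) (mul1+x^-cong m (coeff-1+x^^-*ₚ m a q) k))

-- Coefficient sequences of products of binomials

record ProductShape (D : ℕ) (c : ℕ → ℤ) : Set where
  field
    nonneg     : ∀ k → + 0 ℤ.≤ c k
    vanishes   : ∀ k → D < k → c k ≡ + 0
    top        : + 0 ℤ.< c D
    palindrome : ∀ i j → i + j ≡ D → c i ≡ c j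
    constant   : c 0 ≡ + 1

open ProductShape public

ProductShape-resp : ∀ {D c c′} → c ≗ c′ → ProductShape D c → ProductShape D c′
ProductShape-resp {D} c≗c′ S = record
  { nonneg     = λ k → subst (+ 0 ℤ.≤_) (c≗c′ k) (nonneg S k)
  ; vanishes   = λ k D<k → trans (sym (c≗c′ k)) (vanishes S k D<k)
  ; top        = subst (+ 0 ℤ.<_) (c≗c′ D) (top S)
  ; palindrome = λ i j i+j≡D → trans (sym (c≗c′ i)) (trans (palindrome S i j i+j≡D) (c≗c′ j))
  ; constant   = trans (sym (c≗c′ 0)) (constant S)
  }

oneₚ-shape : ProductShape 0 (coeff oneₚ)
oneₚ-shape = record
  { nonneg     = λ { zero → ℤ.+≤+ z≤n ; (suc k) → ℤP.≤-refl }
  ; vanishes   = λ { (suc k) _ → refl }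
  ; top        = ℤ.+<+ (s≤s z≤n)
  ; palindrome = λ { zero zero _ → refl }
  ; constant   = refl
  }

mul1+x^-positive : ∀ m {c} → (∀ k → + 0 ℤ.≤ c k) → ∀ t → + 0 ℤ.< c t → + 0 ℤ.< mul1+x^ m c t
mul1+x^-positive m c≥0 t c>0 = ℤP.+-mono-<-≤ c>0 (shiftBy-nonneg c≥0 m t)

mul1+x^-positive-shifted : ∀ m {c} → (∀ k → + 0 ℤ.≤ c k) → ∀ t → + 0 ℤ.< c t → + 0 ℤ.< mul1+x^ m c (m + t)
mul1+x^-positive-shifted m {c} c≥0 t c>0 =
  ℤP.+-mono-≤-< (c≥0 (m + t)) (subst (+ 0 ℤ.<_) (sym (shiftBy-+ m c t)) c>0)

module _ {m D : ℕ} {c : ℕ → ℤ} (S : ProductShape D c) where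

  private
    reflected : ∀ i j → i + j ≡ D + m → c i ≡ shiftBy m c j
    reflected i j i+j≡D+m with <-≤-connex j m
    ... | inj₁ j<m = trans (vanishes S i D<i) (sym (shiftBy-below m c j j<m))
      where
      D<i : D < i
      D<i = +-cancelʳ-< j D i (subst (D + j <_) (sym i+j≡D+m) (+-monoʳ-< D j<m))
    ... | inj₂ m≤j = trans (palindrome S i (j ∸ m) i+[j∸m]≡D) (sym (shiftBy-≥ m c m≤j))
      where
      i+[j∸m]≡D : i + (j ∸ m) ≡ D
      i+[j∸m]≡D = +-cancelʳ-≡ m _ D (begin
        i + (j ∸ m) + m  ≡⟨ +-assoc i (j ∸ m) m ⟩
        i + (j ∸ m + m)  ≡⟨ cong (_+_ i) (m∸n+n≡m m≤j) ⟩
        i + j            ≡⟨ i+j≡D+m ⟩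
        D + m            ∎)
        where open ≡-Reasoning

  mul1+x^-shape : 1 ≤ m → ProductShape (D + m) (mul1+x^ m c)
  mul1+x^-shape 1≤m = record
    { nonneg     = λ k → ℤP.+-mono-≤ (nonneg S k) (shiftBy-nonneg (nonneg S) m k)
    ; vanishes   = vanishes′
    ; top        = subst (λ k → + 0 ℤ.< mul1+x^ m c k) (+-comm m D)
                         (mul1+x^-positive-shifted m (nonneg S) D (top S))
    ; palindrome = λ i j i+j≡D+m →
        trans (cong₂ ℤ._+_ (reflected i j i+j≡D+m) (sym (reflected j i (trans (+-comm j i) i+j≡D+m))))
              (ℤP.+-comm (shiftBy m c j) (c j))
    ; constant   = trans (cong (ℤ._+_ (c 0)) (shiftBy-below m c 0 1≤m)) (trans (ℤP.+-identityʳ _) (constant S))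
    }
    where
    vanishes′ : ∀ k → D + m < k → mul1+x^ m c k ≡ + 0
    vanishes′ k D+m<k = cong₂ ℤ._+_ (vanishes S k (≤-<-trans (m≤m+n D m) D+m<k))
                                   (trans (shiftBy-≥ m c m≤k) (vanishes S (k ∸ m) D<k∸m))
      where
      m≤k : m ≤ k
      m≤k = ≤-trans (m≤n+m m D) (<⇒≤ D+m<k)
      D<k∸m : D < k ∸ m
      D<k∸m = +-cancelʳ-< m D (k ∸ m) (subst (D + m <_) (sym (m∸n+n≡m m≤k)) D+m<k)

mulPow1+x^-shape : ∀ {m D c} → 1 ≤ m → ∀ a → ProductShape D c → ProductShape (a * m + D) (mulPow1+x^ m a c)
mulPow1+x^-shape         1≤m zero    S = S
mulPow1+x^-shape {m} {D} {c} 1≤m (suc a) S =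
  subst (λ E → ProductShape E (mulPow1+x^ m (suc a) c)) (trans (+-comm (a * m + D) m) (sym (+-assoc m (a * m) D)))
        (mul1+x^-shape (mulPow1+x^-shape 1≤m a S) 1≤m)

PositiveInWindows : ℕ → ℕ → (ℕ → ℤ) → Set
PositiveInWindows g D c = ∀ k → k ≤ D → ∃[ t ] t ≤ k × k < t + g × + 0 ℤ.< c t

PositiveInWindows-resp : ∀ {g D c c′} → c ≗ c′ → PositiveInWindows g D c → PositiveInWindows g D c′
PositiveInWindows-resp c≗c′ W k k≤D with W k k≤D
... | t , t≤k , k<t+g , c>0 = t , t≤k , k<t+g , subst (+ 0 ℤ.<_) (c≗c′ t) c>0

PositiveInWindows-mono : ∀ {g g′ D c} → g ≤ g′ → PositiveInWindows g D c → PositiveInWindows g′ D c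
PositiveInWindows-mono g≤g′ W k k≤D with W k k≤D
... | t , t≤k , k<t+g , c>0 = t , t≤k , <-≤-trans k<t+g (+-monoʳ-≤ t g≤g′) , c>0

mul1+x^-windows : ∀ {m g D c} → m ≤ g → ProductShape D c → PositiveInWindows g D c →
                  PositiveInWindows g (D + m) (mul1+x^ m c)
mul1+x^-windows {m} {g} {D} m≤g S W k k≤D+m with k ≤? D
... | yes k≤D with W k k≤D
...   | t , t≤k , k<t+g , c>0 = t , t≤k , k<t+g , mul1+x^-positive m (nonneg S) t c>0
mul1+x^-windows {m} {g} {D} m≤g S W k k≤D+m | no k≰D with <-≤-connex k m
... | inj₁ k<m = D , <⇒≤ (≰⇒> k≰D) , <-≤-trans k<m (≤-trans m≤g (m≤n+m g D)) ,
                 mul1+x^-positive m (nonneg S) D (top S)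
... | inj₂ m≤k with W (k ∸ m) k∸m≤D
  where
  k∸m≤D : k ∸ m ≤ D
  k∸m≤D = subst (k ∸ m ≤_) (m+n∸n≡m D m) (∸-monoˡ-≤ m k≤D+m)
...   | t , t≤k∸m , k∸m<t+g , c>0 = m + t , m+t≤k , k<m+t+g , mul1+x^-positive-shifted m (nonneg S) t c>0
  where
  m+[k∸m]≡k : m + (k ∸ m) ≡ k
  m+[k∸m]≡k = m+[n∸m]≡n m≤k
  m+t≤k : m + t ≤ k
  m+t≤k = subst (m + t ≤_) m+[k∸m]≡k (+-monoʳ-≤ m t≤k∸m)
  k<m+t+g : k < m + t + g
  k<m+t+g = subst₂ _<_ m+[k∸m]≡k (sym (+-assoc m t g)) (+-monoʳ-< m k∸m<t+g)

mul1+x-windows : ∀ {g D c} → 1 ≤ g → ProductShape D c → PositiveInWindows (suc g) D c →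
                 PositiveInWindows g (D + 1) (mul1+x^ 1 c)
mul1+x-windows {g} {D} {c} 1≤g S W k k≤D+1 with k ≤? D
... | no k≰D = k , ≤-refl , m<m+n k 1≤g ,
               subst (λ j → + 0 ℤ.< mul1+x^ 1 c j) 1+D≡k (mul1+x^-positive-shifted 1 (nonneg S) D (top S))
  where
  1+D≡k : suc D ≡ k
  1+D≡k = ≤-antisym (≰⇒> k≰D) (subst (k ≤_) (+-comm D 1) k≤D+1)
... | yes k≤D with W k k≤D
... | t , t≤k , k<t+1+g , c>0 with <-≤-connex k (t + g)
...   | inj₁ k<t+g = t , t≤k , k<t+g , mul1+x^-positive 1 (nonneg S) t c>0
...   | inj₂ t+g≤k = suc t , 1+t≤k , k<1+t+g , mul1+x^-positive-shifted 1 (nonneg S) t c>0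
  where
  k≡t+g : k ≡ t + g
  k≡t+g = ≤-antisym (s≤s⁻¹ (subst (suc k ≤_) (+-suc t g) k<t+1+g)) t+g≤k
  1+t≤k : suc t ≤ k
  1+t≤k = subst (suc t ≤_) (sym k≡t+g) (subst (_≤ t + g) (+-comm t 1) (+-monoʳ-≤ t 1≤g))
  k<1+t+g : k < suc t + g
  k<1+t+g = subst (_< suc t + g) (sym k≡t+g) ≤-refl

mulPow1+x^-windows : ∀ {m g D c} → 1 ≤ m → m ≤ g → ∀ a → ProductShape D c → PositiveInWindows g D c →
                     PositiveInWindows g (a * m + D) (mulPow1+x^ m a c)
mulPow1+x^-windows         1≤m m≤g zero    S W = W
mulPow1+x^-windows {m} {g} {D} {c} 1≤m m≤g (suc a) S W =
  subst (λ E → PositiveInWindows g E (mulPow1+x^ m (suc a) c)) (trans (+-comm (a * m + D) m) (sym (+-assoc m (a * m) D)))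
        (mul1+x^-windows m≤g (mulPow1+x^-shape 1≤m a S) (mulPow1+x^-windows 1≤m m≤g a S W))

mulPow1+x-windows : ∀ {g D c} → 1 ≤ g → ∀ a → ProductShape D c → PositiveInWindows (a + g) D c →
                    PositiveInWindows g (a * 1 + D) (mulPow1+x^ 1 a c)
mulPow1+x-windows     1≤g zero    S W = W
mulPow1+x-windows {g} {D} {c} 1≤g (suc a) S W =
  subst (λ E → PositiveInWindows g E (mulPow1+x^ 1 (suc a) c)) (+-comm (a * 1 + D) 1)
        (mul1+x-windows 1≤g (mulPow1+x^-shape ≤-refl a S)
          (mulPow1+x-windows (s≤s z≤n) a S (subst (λ h → PositiveInWindows h D c) (sym (+-suc a g)) W)))

prodₚ : (ℕ → ℕ) → List ℕ → Poly
prodₚ e l = foldr (λ i acc → (1+x^ (2 ^ i) ^ₚ e i) *ₚ acc) oneₚ l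

prodDeg : (ℕ → ℕ) → List ℕ → ℕ
prodDeg e l = foldr (λ i s → e i * 2 ^ i + s) 0 l

coeff-prodₚ-∷ : ∀ e i l → coeff (prodₚ e (i ∷ l)) ≗ mulPow1+x^ (2 ^ i) (e i) (coeff (prodₚ e l))
coeff-prodₚ-∷ e i l = coeff-1+x^^-*ₚ (2 ^ i) (e i) (prodₚ e l)

prodₚ-cong : ∀ {e e′} → (∀ i → e i ≡ e′ i) → ∀ l → prodₚ e l ≡ prodₚ e′ l
prodₚ-cong e≡e′ []      = refl
prodₚ-cong e≡e′ (i ∷ l) = cong₂ (λ a p → (1+x^ (2 ^ i) ^ₚ a) *ₚ p) (e≡e′ i) (prodₚ-cong e≡e′ l)

prodₚ-shape : ∀ e l → ProductShape (prodDeg e l) (coeff (prodₚ e l))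
prodₚ-shape e []      = oneₚ-shape
prodₚ-shape e (i ∷ l) =
  ProductShape-resp (sym ∘ coeff-prodₚ-∷ e i l) (mulPow1+x^-shape (m^n>0 2 i) (e i) (prodₚ-shape e l))

prodₚ-windows : ∀ {K} e l → All (_≤ K) l → PositiveInWindows (2 ^ K) (prodDeg e l) (coeff (prodₚ e l))
prodₚ-windows {K} e []      []           zero _ = 0 , z≤n , m^n>0 2 K , ℤ.+<+ (s≤s z≤n)
prodₚ-windows     e (i ∷ l) (i≤K ∷ l≤K) =
  PositiveInWindows-resp (sym ∘ coeff-prodₚ-∷ e i l)
    (mulPow1+x^-windows (m^n>0 2 i) (^-monoʳ-≤ 2 i≤K) (e i) (prodₚ-shape e l) (prodₚ-windows e l l≤K))

mul1+x^-below : ∀ m c {k} → k < m → mul1+x^ m c k ≡ c k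
mul1+x^-below m c {k} k<m = trans (cong (ℤ._+_ (c k)) (shiftBy-below m c k k<m)) (ℤP.+-identityʳ (c k))

mulPow1+x^-below : ∀ m a c {k} → k < m → mulPow1+x^ m a c k ≡ c k
mulPow1+x^-below m zero    c k<m = refl
mulPow1+x^-below m (suc a) c k<m = trans (mul1+x^-below m (mulPow1+x^ m a c) k<m) (mulPow1+x^-below m a c k<m)

prodₚ-below : ∀ e l {k} → All (λ i → k < 2 ^ i) l → coeff (prodₚ e l) k ≡ coeff oneₚ k
prodₚ-below e []      []                = refl
prodₚ-below e (i ∷ l) (k<2^i ∷ k<2^l) =
  trans (coeff-prodₚ-∷ e i l _) (trans (mulPow1+x^-below (2 ^ i) (e i) _ k<2^i) (prodₚ-below e l k<2^l))

mulPow1+x^-coeff : ∀ m a c → 1 ≤ m → c 0 ≡ + 1 → mulPow1+x^ m a c m ≡ c m ℤ.+ + a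
mulPow1+x^-coeff m zero    c 1≤m c₀≡1 = sym (ℤP.+-identityʳ (c m))
mulPow1+x^-coeff m (suc a) c 1≤m c₀≡1 = begin
  mulPow1+x^ m a c m ℤ.+ shiftBy m (mulPow1+x^ m a c) m
    ≡⟨ cong (ℤ._+_ (mulPow1+x^ m a c m)) (trans (cong (shiftBy m (mulPow1+x^ m a c)) (sym (+-identityʳ m)))
                                                (shiftBy-+ m (mulPow1+x^ m a c) 0)) ⟩
  mulPow1+x^ m a c m ℤ.+ mulPow1+x^ m a c 0
    ≡⟨ cong₂ ℤ._+_ (mulPow1+x^-coeff m a c 1≤m c₀≡1) (trans (mulPow1+x^-below m a c 1≤m) c₀≡1) ⟩
  c m ℤ.+ + a ℤ.+ + 1
    ≡⟨ ℤP.+-assoc (c m) (+ a) (+ 1) ⟩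
  c m ℤ.+ + (a + 1)
    ≡⟨ cong (λ n → c m ℤ.+ + n) (+-comm a 1) ⟩
  c m ℤ.+ + suc a ∎
  where open ≡-Reasoning

mulPow1+x-coeff₂ : ∀ a c → c 0 ≡ + 1 → mulPow1+x^ 1 a c 2 ≡ c 2 ℤ.+ + a ℤ.* c 1 ℤ.+ + (a C 2)
mulPow1+x-coeff₂ zero    c c₀≡1 = pad (c 2) (c 1)
  where
  pad : ∀ x y → x ≡ x ℤ.+ + 0 ℤ.* y ℤ.+ + 0
  pad = solve-∀
mulPow1+x-coeff₂ (suc a) c c₀≡1 = begin
  mulPow1+x^ 1 a c 2 ℤ.+ mulPow1+x^ 1 a c 1
    ≡⟨ cong₂ ℤ._+_ (mulPow1+x-coeff₂ a c c₀≡1) (mulPow1+x^-coeff 1 a c ≤-refl c₀≡1) ⟩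
  c 2 ℤ.+ + a ℤ.* c 1 ℤ.+ + (a C 2) ℤ.+ (c 1 ℤ.+ + a)
    ≡⟨ regroup (c 2) (c 1) (+ a) (+ (a C 2)) ⟩
  c 2 ℤ.+ (+ 1 ℤ.+ + a) ℤ.* c 1 ℤ.+ (+ a ℤ.+ + (a C 2))
    ≡⟨ cong (λ n → c 2 ℤ.+ + suc a ℤ.* c 1 ℤ.+ + n) (sym (suc-C₂ a)) ⟩
  c 2 ℤ.+ + suc a ℤ.* c 1 ℤ.+ + (suc a C 2) ∎
  where
  open ≡-Reasoning
  regroup : ∀ x y A B → x ℤ.+ A ℤ.* y ℤ.+ B ℤ.+ (y ℤ.+ A) ≡ x ℤ.+ (+ 1 ℤ.+ A) ℤ.* y ℤ.+ (A ℤ.+ B)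
  regroup = solve-∀
  suc-C₂ : ∀ a → suc a C 2 ≡ a + a C 2
  suc-C₂ a = trans (sym (nCk+nC[k+1]≡[n+1]C[k+1] a 1)) (cong (_+ a C 2) (nC1≡n a))

prodₚ-coeff₀ : ∀ e l → coeff (prodₚ e l) 0 ≡ + 1
prodₚ-coeff₀ e l = constant (prodₚ-shape e l)

prodₚ-coeff₁ : ∀ e K → coeff (prodₚ e (upTo (suc K))) 1 ≡ + e 0
prodₚ-coeff₁ e K = begin
  coeff (prodₚ e (0 ∷ applyUpTo suc K)) 1 ≡⟨ coeff-prodₚ-∷ e 0 (applyUpTo suc K) 1 ⟩
  mulPow1+x^ 1 (e 0) c 1                  ≡⟨ mulPow1+x^-coeff 1 (e 0) c ≤-refl (prodₚ-coeff₀ e (applyUpTo suc K)) ⟩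
  c 1 ℤ.+ + e 0                           ≡⟨ cong (ℤ._+ + e 0) (prodₚ-below e (applyUpTo suc K) (applyUpTo⁺₂ suc K 1<2^[1+j])) ⟩
  + e 0                                   ∎
  where
  open ≡-Reasoning
  c = coeff (prodₚ e (applyUpTo suc K))
  1<2^[1+j] : ∀ j → 1 < 2 ^ suc j
  1<2^[1+j] j = ^-monoʳ-≤ 2 (s≤s (z≤n {j}))

prodₚ-coeff₂ : ∀ e K → coeff (prodₚ e (upTo (suc (suc K)))) 2 ≡ + (e 0 C 2 + e 1)
prodₚ-coeff₂ e K = begin
  coeff (prodₚ e (0 ∷ 1 ∷ tail)) 2                 ≡⟨ coeff-prodₚ-∷ e 0 (1 ∷ tail) 2 ⟩
  mulPow1+x^ 1 (e 0) c 2                           ≡⟨ mulPow1+x-coeff₂ (e 0) c (prodₚ-coeff₀ e (1 ∷ tail)) ⟩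
  c 2 ℤ.+ + e 0 ℤ.* c 1 ℤ.+ + (e 0 C 2)            ≡⟨ cong₂ (λ x y → x ℤ.+ + e 0 ℤ.* y ℤ.+ + (e 0 C 2)) c₂≡e₁ c₁≡0 ⟩
  + e 1 ℤ.+ + e 0 ℤ.* + 0 ℤ.+ + (e 0 C 2)          ≡⟨ drop-zero (+ e 1) (+ e 0) (+ (e 0 C 2)) ⟩
  + (e 0 C 2 + e 1)                                ∎
  where
  open ≡-Reasoning
  drop-zero : ∀ x y z → x ℤ.+ y ℤ.* + 0 ℤ.+ z ≡ z ℤ.+ x
  drop-zero = solve-∀
  tail = applyUpTo (suc ∘ suc) K
  c = coeff (prodₚ e (1 ∷ tail))
  c′ = coeff (prodₚ e tail)
  2<2^[2+j] : ∀ j → 2 < 2 ^ suc (suc j)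
  2<2^[2+j] j = <-≤-trans (s≤s (s≤s (s≤s z≤n))) (^-monoʳ-≤ 2 (s≤s (s≤s (z≤n {j}))))
  c′-below : ∀ {k} → k ≤ 2 → c′ k ≡ coeff oneₚ k
  c′-below k≤2 = prodₚ-below e tail (applyUpTo⁺₂ (suc ∘ suc) K (λ j → ≤-<-trans k≤2 (2<2^[2+j] j)))
  c₂≡e₁ : c 2 ≡ + e 1
  c₂≡e₁ = begin
    c 2                      ≡⟨ coeff-prodₚ-∷ e 1 tail 2 ⟩
    mulPow1+x^ 2 (e 1) c′ 2  ≡⟨ mulPow1+x^-coeff 2 (e 1) c′ (s≤s z≤n) (prodₚ-coeff₀ e tail) ⟩
    c′ 2 ℤ.+ + e 1           ≡⟨ cong (ℤ._+ + e 1) (c′-below ≤-refl) ⟩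
    + e 1                    ∎
  c₁≡0 : c 1 ≡ + 0
  c₁≡0 = trans (coeff-prodₚ-∷ e 1 tail 1) (trans (mulPow1+x^-below 2 (e 1) c′ ≤-refl) (c′-below (s≤s z≤n)))

-- Binary partitions

boxes⁺ : ∀ {ms bs} → Pointwise _≤_ ms bs → ms ∈ boxes bs
boxes⁺ []                          = here refl
boxes⁺ {m ∷ ms} {b ∷ bs} (m≤b ∷ ms≤bs) =
  ∈-concatMap⁺ (λ j → map (j ∷_) (boxes bs))
    (Any.map (λ { refl → ∈-map⁺ (m ∷_) (boxes⁺ ms≤bs) }) (∈-upTo⁺ (s≤s m≤b)))

boxes⁻ : ∀ {ms} bs → ms ∈ boxes bs → Pointwise _≤_ ms bs
boxes⁻ []       (here refl) = []
boxes⁻ {ms} (b ∷ bs) ms∈    = go (upTo (suc b)) (λ j → s≤s⁻¹ ∘ ∈-upTo⁻) (∈-concatMap⁻ _ ms∈)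
  where
  go : ∀ js → (∀ j → j ∈ js → j ≤ b) → Any (λ j → ms ∈ map (j ∷_) (boxes bs)) js → Pointwise _≤_ ms (b ∷ bs)
  go (j ∷ js) ≤b (here p) with ∈-map⁻ (j ∷_) p
  ... | ρ , ρ∈ , refl = ≤b j (here refl) ∷ boxes⁻ bs ρ∈
  go (j ∷ js) ≤b (there p) = go js (λ i → ≤b i ∘ there) p

weightFrom-suc : ∀ s ms → weightFrom (suc s) ms ≡ 2 * weightFrom s ms
weightFrom-suc s []       = refl
weightFrom-suc s (m ∷ ms) = begin
  m * (2 * 2 ^ s) + weightFrom (suc (suc s)) ms ≡⟨ cong₂ _+_ (x*[2*y]≡2*[x*y] m (2 ^ s)) (weightFrom-suc (suc s) ms) ⟩
  2 * (m * 2 ^ s) + 2 * weightFrom (suc s) ms   ≡⟨ *-distribˡ-+ 2 (m * 2 ^ s) _ ⟨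
  2 * (m * 2 ^ s + weightFrom (suc s) ms)       ∎
  where
  open ≡-Reasoning
  x*[2*y]≡2*[x*y] : ∀ x y → x * (2 * y) ≡ 2 * (x * y)
  x*[2*y]≡2*[x*y] = ℕ-solve-∀

weight-∷ : ∀ m ρ → weightFrom 0 (m ∷ ρ) ≡ m + 2 * weightFrom 0 ρ
weight-∷ m ρ = cong₂ _+_ (*-identityʳ m) (weightFrom-suc 0 ρ)

partitionsWithin : List ℕ → ℕ → List (List ℕ)
partitionsWithin bs k = filter (λ ms → weightFrom 0 ms ≟ k) (boxes bs)

bounds : ℕ → List ℕ
bounds n = map (n /2^_) (upTo (suc (L n)))

tailBounds : ℕ → List ℕ
tailBounds n = map (n /2^_) (applyUpTo suc (L n))

hExp : ℕ → List ℕ → ℕ → ℕ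
hExp n ms i = n /2^ i ∸ mult ms i

∈𝓑⁻ : ∀ {n ms} → ms ∈ 𝓑 n → weightFrom 0 ms ≡ n × Pointwise _≤_ ms (bounds n)
∈𝓑⁻ {n} ms∈ with ∈-filter⁻ (λ ms → weightFrom 0 ms ≟ n) ms∈
... | ms∈boxes , w≡n = w≡n , boxes⁻ (bounds n) ms∈boxes

∈𝓑⁺ : ∀ {n ms} → weightFrom 0 ms ≡ n → Pointwise _≤_ ms (bounds n) → ms ∈ 𝓑 n
∈𝓑⁺ {n} w≡n ms≤ = ∈-filter⁺ (λ ms → weightFrom 0 ms ≟ n) (boxes⁺ ms≤) w≡n

prodDeg-∸ : ∀ E μ l → All (λ i → μ i ≤ E i) l → prodDeg (λ i → E i ∸ μ i) l + prodDeg μ l ≡ prodDeg E l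
prodDeg-∸ E μ []      []           = refl
prodDeg-∸ E μ (i ∷ l) (μ≤E ∷ μ≤Es) = begin
  (E i ∸ μ i) * 2 ^ i + rest + (μ i * 2 ^ i + restμ) ≡⟨ +-+-comm ((E i ∸ μ i) * 2 ^ i) rest (μ i * 2 ^ i) restμ ⟩
  ((E i ∸ μ i) * 2 ^ i + μ i * 2 ^ i) + (rest + restμ) ≡⟨ cong₂ _+_ recombine (prodDeg-∸ E μ l μ≤Es) ⟩
  E i * 2 ^ i + prodDeg E l ∎
  where
  open ≡-Reasoning
  rest = prodDeg (λ i → E i ∸ μ i) l
  restμ = prodDeg μ l
  +-+-comm : ∀ a b c d → a + b + (c + d) ≡ (a + c) + (b + d)
  +-+-comm = ℕ-solve-∀
  recombine : (E i ∸ μ i) * 2 ^ i + μ i * 2 ^ i ≡ E i * 2 ^ i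
  recombine = trans (sym (*-distribʳ-+ (2 ^ i) (E i ∸ μ i) (μ i))) (cong (_* 2 ^ i) (m∸n+n≡m μ≤E))

prodDeg-shift : ∀ e (f : ℕ → ℕ) K → prodDeg e (applyUpTo (suc ∘ f) K) ≡ 2 * prodDeg (e ∘ suc) (applyUpTo f K)
prodDeg-shift e f zero    = refl
prodDeg-shift e f (suc K) = begin
  e (suc (f 0)) * (2 * 2 ^ f 0) + prodDeg e (applyUpTo (suc ∘ f ∘ suc) K)
    ≡⟨ cong₂ _+_ (x*[2*y]≡2*[x*y] (e (suc (f 0))) (2 ^ f 0)) (prodDeg-shift e (f ∘ suc) K) ⟩
  2 * (e (suc (f 0)) * 2 ^ f 0) + 2 * prodDeg (e ∘ suc) (applyUpTo (f ∘ suc) K)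
    ≡⟨ *-distribˡ-+ 2 (e (suc (f 0)) * 2 ^ f 0) (prodDeg (e ∘ suc) (applyUpTo (f ∘ suc) K)) ⟨
  2 * prodDeg (e ∘ suc) (applyUpTo f (suc K)) ∎
  where
  open ≡-Reasoning
  x*[2*y]≡2*[x*y] : ∀ x y → x * (2 * y) ≡ 2 * (x * y)
  x*[2*y]≡2*[x*y] = ℕ-solve-∀

prodDeg-mult : ∀ ms K → length ms ≤ K → prodDeg (mult ms) (upTo K) ≡ weightFrom 0 ms
prodDeg-mult []       K       _           = prodDeg-zero (upTo K)
  where
  prodDeg-zero : ∀ l → prodDeg (mult []) l ≡ 0
  prodDeg-zero []      = refl
  prodDeg-zero (i ∷ l) = prodDeg-zero l
prodDeg-mult (m ∷ ms) (suc K) (s≤s len≤K) = cong (_+_ (m * 1)) (begin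
  prodDeg (mult (m ∷ ms)) (applyUpTo suc K) ≡⟨ prodDeg-shift (mult (m ∷ ms)) id K ⟩
  2 * prodDeg (mult ms) (upTo K)            ≡⟨ cong (2 *_) (prodDeg-mult ms K len≤K) ⟩
  2 * weightFrom 0 ms                       ≡⟨ weightFrom-suc 0 ms ⟨
  weightFrom 1 ms                           ∎)
  where open ≡-Reasoning

mult-≤ : ∀ {ms bs} → Pointwise _≤_ ms bs → ∀ i → mult ms i ≤ mult bs i
mult-≤ []            i       = z≤n
mult-≤ (m≤b ∷ ms≤bs) zero    = m≤b
mult-≤ (m≤b ∷ ms≤bs) (suc i) = mult-≤ ms≤bs i

mult-applyUpTo : ∀ f K i → i < K → mult (applyUpTo f K) i ≡ f i
mult-applyUpTo f (suc K) zero    _         = refl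
mult-applyUpTo f (suc K) (suc i) (s≤s i<K) = mult-applyUpTo (f ∘ suc) K i i<K

weightFrom-zeros : ∀ s K → weightFrom s (replicate K 0) ≡ 0
weightFrom-zeros s zero    = refl
weightFrom-zeros s (suc K) = weightFrom-zeros (suc s) K

zeros≤ : ∀ K (g f : ℕ → ℕ) → Pointwise _≤_ (replicate K 0) (map g (applyUpTo f K))
zeros≤ zero    g f = []
zeros≤ (suc K) g f = z≤n ∷ zeros≤ K g (f ∘ suc)

mult-zeros : ∀ K j → mult (replicate K 0) j ≡ 0
mult-zeros zero    j       = refl
mult-zeros (suc K) zero    = refl
mult-zeros (suc K) (suc j) = mult-zeros K j

does-⇔ : ∀ {A B : Set} (a? : Dec A) (b? : Dec B) → (A → B) → (B → A) → does a? ≡ does b?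
does-⇔ a? (yes b) A→B B→A = dec-true a? (B→A b)
does-⇔ a? (no ¬b) A→B B→A = dec-false a? (¬b ∘ A→B)

module FiniteSums (R : CommutativeSemiring 0ℓ 0ℓ) where

  open CommutativeSemiring R
    using (Carrier; _≈_; 0#; 1#; setoid; reflexive; zeroʳ; distribˡ)
    renaming ( _+_ to _⊕_; _*_ to _⊗_; refl to ≈-refl; sym to ≈-sym; trans to ≈-trans
             ; +-cong to ⊕-cong; +-assoc to ⊕-assoc; +-comm to ⊕-comm; *-cong to ⊗-cong
             ; +-identityˡ to ⊕-identityˡ; +-identityʳ to ⊕-identityʳ)
  open import Relation.Binary.Reasoning.Setoid setoid

  ∑ : {A : Set} → List A → (A → Carrier) → Carrier
  ∑ l f = foldr (λ x acc → f x ⊕ acc) 0# l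

  when : Bool → Carrier → Carrier
  when b v = if b then v else 0#

  ∑-cong : ∀ {A} (l : List A) {f g} → (∀ x → x ∈ l → f x ≈ g x) → ∑ l f ≈ ∑ l g
  ∑-cong []      f≈g = ≈-refl
  ∑-cong (x ∷ l) f≈g = ⊕-cong (f≈g x (here refl)) (∑-cong l (λ y → f≈g y ∘ there))

  ∑-zero : ∀ {A} (l : List A) {f} → (∀ x → x ∈ l → f x ≈ 0#) → ∑ l f ≈ 0#
  ∑-zero []      f≈0 = ≈-refl
  ∑-zero (x ∷ l) f≈0 = ≈-trans (⊕-cong (f≈0 x (here refl)) (∑-zero l (λ y → f≈0 y ∘ there))) (⊕-identityˡ 0#)

  ∑-++ : ∀ {A} (l₁ l₂ : List A) f → ∑ (l₁ ++ l₂) f ≈ ∑ l₁ f ⊕ ∑ l₂ f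
  ∑-++ []       l₂ f = ≈-sym (⊕-identityˡ _)
  ∑-++ (x ∷ l₁) l₂ f = ≈-trans (⊕-cong ≈-refl (∑-++ l₁ l₂ f)) (≈-sym (⊕-assoc _ _ _))

  ∑-map : ∀ {A B} (h : A → B) (l : List A) f → ∑ (map h l) f ≈ ∑ l (f ∘ h)
  ∑-map h []      f = ≈-refl
  ∑-map h (x ∷ l) f = ⊕-cong ≈-refl (∑-map h l f)

  ∑-concatMap : ∀ {A B} (g : A → List B) (l : List A) f → ∑ (concatMap g l) f ≈ ∑ l (λ y → ∑ (g y) f)
  ∑-concatMap g []      f = ≈-refl
  ∑-concatMap g (x ∷ l) f = ≈-trans (∑-++ (g x) (concat (map g l)) f) (⊕-cong ≈-refl (∑-concatMap g l f))

  ∑-filter : ∀ {A} {P : A → Set} (P? : ∀ x → Dec (P x)) (l : List A) f →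
             ∑ (filter P? l) f ≈ ∑ l (λ x → when (does (P? x)) (f x))
  ∑-filter P? []      f = ≈-refl
  ∑-filter P? (x ∷ l) f with does (P? x)
  ... | true  = ⊕-cong ≈-refl (∑-filter P? l f)
  ... | false = ≈-trans (∑-filter P? l f) (≈-sym (⊕-identityˡ _))

  ∑-*ˡ : ∀ {A} (l : List A) c f → c ⊗ ∑ l f ≈ ∑ l (λ x → c ⊗ f x)
  ∑-*ˡ []      c f = zeroʳ c
  ∑-*ˡ (x ∷ l) c f = ≈-trans (distribˡ c _ _) (⊕-cong ≈-refl (∑-*ˡ l c f))

  ∏ : List ℕ → (ℕ → Carrier) → Carrier
  ∏ l f = foldr (λ i acc → f i ⊗ acc) 1# l

  ∏-cong : ∀ l {f g} → (∀ i → f i ≈ g i) → ∏ l f ≈ ∏ l g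
  ∏-cong []      f≈g = ≈-refl
  ∏-cong (i ∷ l) f≈g = ⊗-cong (f≈g i) (∏-cong l f≈g)

  ∏-applyUpTo-suc : ∀ K f → ∏ (applyUpTo suc K) f ≈ ∏ (upTo K) (f ∘ suc)
  ∏-applyUpTo-suc K f = reflexive (trans (cong (λ l → ∏ l f) (sym (map-upTo suc K))) (∏-map (upTo K)))
    where
    ∏-map : ∀ l → ∏ (map suc l) f ≡ ∏ l (f ∘ suc)
    ∏-map []      = refl
    ∏-map (i ∷ l) = cong (f (suc i) ⊗_) (∏-map l)

  when-cong : ∀ b {u v} → u ≈ v → when b u ≈ when b v
  when-cong true  u≈v = u≈v
  when-cong false _   = ≈-refl

  when-*ˡ : ∀ b c v → c ⊗ when b v ≈ when b (c ⊗ v)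
  when-*ˡ true  c v = ≈-refl
  when-*ˡ false c v = zeroʳ c

  ∑-upTo-suc : ∀ b h → ∑ (upTo (suc b)) h ≈ h 0 ⊕ ∑ (upTo b) (h ∘ suc)
  ∑-upTo-suc b h =
    ⊕-cong ≈-refl (≈-trans (reflexive (cong (λ l → ∑ l h) (sym (map-upTo suc b)))) (∑-map suc (upTo b) h))

  ∑-upTo-∷ʳ : ∀ K h → ∑ (upTo (suc K)) h ≈ ∑ (upTo K) h ⊕ h K
  ∑-upTo-∷ʳ K h = begin
    ∑ (upTo (suc K)) h        ≡⟨ cong (λ l → ∑ l h) (sym (upTo-∷ʳ K)) ⟩
    ∑ (upTo K ++ [ K ]) h     ≈⟨ ∑-++ (upTo K) [ K ] h ⟩
    ∑ (upTo K) h ⊕ (h K ⊕ 0#) ≈⟨ ⊕-cong ≈-refl (⊕-identityʳ (h K)) ⟩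
    ∑ (upTo K) h ⊕ h K        ∎

  ∑-upTo-single : ∀ K {a} h → a < K → (∀ m → m < K → m ≢ a → h m ≈ 0#) → ∑ (upTo K) h ≈ h a
  ∑-upTo-single (suc K) {a} h a<1+K h≈0 with a ≟ K
  ... | yes refl = begin
    ∑ (upTo (suc a)) h ≈⟨ ∑-upTo-∷ʳ a h ⟩
    ∑ (upTo a) h ⊕ h a ≈⟨ ⊕-cong (∑-zero (upTo a) (λ m m∈ → h≈0 m (m<n⇒m<1+n (∈-upTo⁻ m∈)) (<⇒≢ (∈-upTo⁻ m∈))))
                                 ≈-refl ⟩
    0# ⊕ h a           ≈⟨ ⊕-identityˡ (h a) ⟩
    h a                ∎
  ... | no a≢K = begin
    ∑ (upTo (suc K)) h ≈⟨ ∑-upTo-∷ʳ K h ⟩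
    ∑ (upTo K) h ⊕ h K ≈⟨ ⊕-cong (∑-upTo-single K h a<K (λ m m<K → h≈0 m (m<n⇒m<1+n m<K))) (h≈0 K ≤-refl (a≢K ∘ sym)) ⟩
    h a ⊕ 0#           ≈⟨ ⊕-identityʳ (h a) ⟩
    h a                ∎
    where
    a<K : a < K
    a<K = ≤∧≢⇒< (s≤s⁻¹ a<1+K) a≢K

  ∑-upTo-pair : ∀ K {a b} h → a < K → b < K → a ≢ b → (∀ m → m < K → m ≢ a → m ≢ b → h m ≈ 0#) →
                ∑ (upTo K) h ≈ h a ⊕ h b
  ∑-upTo-pair (suc K) {a} {b} h a<1+K b<1+K a≢b h≈0 with a ≟ K | b ≟ K
  ... | yes refl | yes refl = ⊥-elim (a≢b refl)
  ... | yes refl | no b≢K = begin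
    ∑ (upTo (suc a)) h ≈⟨ ∑-upTo-∷ʳ a h ⟩
    ∑ (upTo a) h ⊕ h a ≈⟨ ⊕-cong (∑-upTo-single a h (≤∧≢⇒< (s≤s⁻¹ b<1+K) b≢K)
                                   (λ m m<a m≢b → h≈0 m (m<n⇒m<1+n m<a) (<⇒≢ m<a) m≢b)) ≈-refl ⟩
    h b ⊕ h a          ≈⟨ ⊕-comm (h b) (h a) ⟩
    h a ⊕ h b          ∎
  ... | no a≢K | yes refl = begin
    ∑ (upTo (suc b)) h ≈⟨ ∑-upTo-∷ʳ b h ⟩
    ∑ (upTo b) h ⊕ h b ≈⟨ ⊕-cong (∑-upTo-single b h (≤∧≢⇒< (s≤s⁻¹ a<1+K) a≢K)
                                   (λ m m<b m≢a → h≈0 m (m<n⇒m<1+n m<b) m≢a (<⇒≢ m<b))) ≈-refl ⟩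
    h a ⊕ h b          ∎
  ... | no a≢K | no b≢K = begin
    ∑ (upTo (suc K)) h        ≈⟨ ∑-upTo-∷ʳ K h ⟩
    ∑ (upTo K) h ⊕ h K        ≈⟨ ⊕-cong (∑-upTo-pair K h (≤∧≢⇒< (s≤s⁻¹ a<1+K) a≢K) (≤∧≢⇒< (s≤s⁻¹ b<1+K) b≢K) a≢b
                                          (λ m m<K → h≈0 m (m<n⇒m<1+n m<K)))
                                        (h≈0 K ≤-refl (a≢K ∘ sym) (b≢K ∘ sym)) ⟩
    (h a ⊕ h b) ⊕ 0#          ≈⟨ ⊕-identityʳ _ ⟩
    h a ⊕ h b                 ∎

  -- The partitions of k with exactly m parts 1, the remaining parts halved (so they weigh (k - m)/2).
  fiber : List ℕ → ℕ → ℕ → (List ℕ → Carrier) → Carrier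
  fiber bs k m g = ∑ (boxes bs) (λ ρ → when (does (m + 2 * weightFrom 0 ρ ≟ k)) (g ρ))

  ∑-partitions-peel : ∀ b bs k f →
    ∑ (partitionsWithin (b ∷ bs) k) f ≈ ∑ (upTo (suc b)) (λ m → fiber bs k m (f ∘ (m ∷_)))
  ∑-partitions-peel b bs k f = begin
    ∑ (filter P? (boxes (b ∷ bs))) f
      ≈⟨ ∑-filter P? (boxes (b ∷ bs)) f ⟩
    ∑ (concatMap (λ m → map (m ∷_) (boxes bs)) (upTo (suc b))) F
      ≈⟨ ∑-concatMap (λ m → map (m ∷_) (boxes bs)) (upTo (suc b)) F ⟩
    ∑ (upTo (suc b)) (λ m → ∑ (map (m ∷_) (boxes bs)) F)
      ≈⟨ ∑-cong (upTo (suc b)) (λ m _ → ≈-trans (∑-map (m ∷_) (boxes bs) F)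
           (∑-cong (boxes bs) (λ ρ _ → reflexive (cong (λ w → when (does (w ≟ k)) (f (m ∷ ρ))) (weight-∷ m ρ))))) ⟩
    ∑ (upTo (suc b)) (λ m → fiber bs k m (f ∘ (m ∷_))) ∎
    where
    P? = λ ms → weightFrom 0 ms ≟ k
    F = λ ms → when (does (P? ms)) (f ms)

  fiber-≡ : ∀ bs {k m j} g → m + 2 * j ≡ k → fiber bs k m g ≈ ∑ (partitionsWithin bs j) g
  fiber-≡ bs {k} {m} {j} g m+2j≡k = ≈-trans
    (∑-cong (boxes bs) (λ ρ _ → reflexive (cong (λ b → when b (g ρ))
      (does-⇔ (m + 2 * weightFrom 0 ρ ≟ k) (weightFrom 0 ρ ≟ j)
         (λ m+2w≡k → *-cancelˡ-≡ _ _ 2 (+-cancelˡ-≡ m _ _ (trans m+2w≡k (sym m+2j≡k))))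
         (λ w≡j → trans (cong (λ w → m + 2 * w) w≡j) m+2j≡k)))))
    (≈-sym (∑-filter (λ ρ → weightFrom 0 ρ ≟ j) (boxes bs) g))

  fiber-empty : ∀ bs {k m} g → (∀ j → m + 2 * j ≢ k) → fiber bs k m g ≈ 0#
  fiber-empty bs {k} {m} g m+2j≢k =
    ∑-zero (boxes bs) (λ ρ _ → reflexive (cong (λ b → when b (g ρ))
      (dec-false (m + 2 * weightFrom 0 ρ ≟ k) (m+2j≢k (weightFrom 0 ρ)))))

  fiber-zero : ∀ bs k m {g} → (∀ ρ → g ρ ≈ 0#) → fiber bs k m g ≈ 0#
  fiber-zero bs k m {g} g≈0 = ∑-zero (boxes bs) (λ ρ _ → when-zero (does (m + 2 * weightFrom 0 ρ ≟ k)) (g≈0 ρ))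
    where
    when-zero : ∀ b {v} → v ≈ 0# → when b v ≈ 0#
    when-zero true  v≈0 = v≈0
    when-zero false _   = ≈-refl

  fiber-*ˡ : ∀ bs k m c {g g′} → (∀ ρ → g ρ ≈ c ⊗ g′ ρ) → fiber bs k m g ≈ c ⊗ fiber bs k m g′
  fiber-*ˡ bs k m c {g} {g′} g≈cg′ = ≈-sym (≈-trans (∑-*ˡ (boxes bs) c _)
    (∑-cong (boxes bs) (λ ρ _ → ≈-trans (when-*ˡ (does (m + 2 * weightFrom 0 ρ ≟ k)) c (g′ ρ))
                                          (when-cong (does (m + 2 * weightFrom 0 ρ ≟ k)) (≈-sym (g≈cg′ ρ))))))

  ∑-partitions-of-0 : ∀ bs g → ∑ (partitionsWithin bs 0) g ≈ g (replicate (length bs) 0)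
  ∑-partitions-of-0 []       g = ⊕-identityʳ (g [])
  ∑-partitions-of-0 (b ∷ bs) g = begin
    ∑ (partitionsWithin (b ∷ bs) 0) g
      ≈⟨ ∑-partitions-peel b bs 0 g ⟩
    ∑ (upTo (suc b)) (λ m → fiber bs 0 m (g ∘ (m ∷_)))
      ≈⟨ ∑-upTo-suc b _ ⟩
    fiber bs 0 0 (g ∘ (0 ∷_)) ⊕ ∑ (upTo b) (λ m → fiber bs 0 (suc m) (g ∘ (suc m ∷_)))
      ≈⟨ ⊕-cong (fiber-≡ bs {0} {0} {0} (g ∘ (0 ∷_)) refl)
                (∑-zero (upTo b) (λ m _ → fiber-empty bs {0} {suc m} (g ∘ (suc m ∷_)) (λ _ ()))) ⟩
    ∑ (partitionsWithin bs 0) (g ∘ (0 ∷_)) ⊕ 0#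
      ≈⟨ ⊕-identityʳ _ ⟩
    ∑ (partitionsWithin bs 0) (g ∘ (0 ∷_))
      ≈⟨ ∑-partitions-of-0 bs (g ∘ (0 ∷_)) ⟩
    g (replicate (length (b ∷ bs)) 0) ∎

-- Arithmetic of ⌊n/2^i⌋, ⌊log₂ n⌋ and the 2-adic valuation

/2^-zero : ∀ n → n /2^ 0 ≡ n
/2^-zero = n/1≡n

/2^-suc : ∀ n i → n /2^ suc i ≡ (n / 2) /2^ i
/2^-suc n i = sym (m/n/o≡m/[n*o] n 2 (2 ^ i) {{_}} {{m^n≢0 2 i}} {{m^n≢0 2 (suc i)}})

[2n]/2≡n : ∀ n → (2 * n) / 2 ≡ n
[2n]/2≡n n = trans (cong (_/ 2) (*-comm 2 n)) (m*n/n≡m n 2)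

[2n+1]/2≡n : ∀ n → (2 * n + 1) / 2 ≡ n
[2n+1]/2≡n zero    = refl
[2n+1]/2≡n (suc n) = trans (m/n≡1+[m∸n]/n {2 * suc n + 1} {2} 2≤) (cong suc (trans (cong (_/ 2) eq) ([2n+1]/2≡n n)))
  where
  2≤ : 2 ≤ 2 * suc n + 1
  2≤ = ≤-trans (*-monoʳ-≤ 2 (s≤s (z≤n {n}))) (m≤m+n (2 * suc n) 1)
  eq : 2 * suc n + 1 ∸ 2 ≡ 2 * n + 1
  eq = cong (λ m → m + 1 ∸ 2) (*-distribˡ-+ 2 1 n)

L-half : ∀ n → 2 ≤ n → L n ≡ suc (L (n / 2))
L-half n 2≤n = begin
  L n                 ≡⟨ m∸n+n≡m 1≤L ⟨
  L n ∸ 1 + 1         ≡⟨ +-comm (L n ∸ 1) 1 ⟩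
  suc (L n ∸ 1)       ≡⟨ cong suc (⌊log₂⌊n/2⌋⌋≡⌊log₂n⌋∸1 n) ⟨
  suc (L ⌊ n /2⌋)     ≡⟨ cong (suc ∘ L) (⌊n/2⌋≡n/2 n) ⟩
  suc (L (n / 2))     ∎
  where
  open ≡-Reasoning
  1≤L : 1 ≤ L n
  1≤L = ⌊log₂⌋-mono-≤ 2≤n
  ⌊n/2⌋≡n/2 : ∀ n → ⌊ n /2⌋ ≡ n / 2
  ⌊n/2⌋≡n/2 zero          = refl
  ⌊n/2⌋≡n/2 (suc zero)    = refl
  ⌊n/2⌋≡n/2 (suc (suc n)) = trans (cong suc (⌊n/2⌋≡n/2 n)) (sym (m/n≡1+[m∸n]/n {suc (suc n)} {2} (s≤s (s≤s z≤n))))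

L-bounds : ∀ n → 1 ≤ n → 2 ^ L n ≤ n × n < 2 ^ suc (L n)
L-bounds = <-rec (λ n → 1 ≤ n → 2 ^ L n ≤ n × n < 2 ^ suc (L n)) squeeze
  where
  squeeze : ∀ n → (∀ {m} → m < n → 1 ≤ m → 2 ^ L m ≤ m × m < 2 ^ suc (L m)) → 1 ≤ n → 2 ^ L n ≤ n × n < 2 ^ suc (L n)
  squeeze (suc zero)    rec _ = s≤s z≤n , s≤s (s≤s z≤n)
  squeeze (suc (suc k)) rec _ = subst (λ l → 2 ^ l ≤ n × n < 2 ^ suc l) (sym (L-half n (s≤s (s≤s z≤n)))) (lower , upper)
    where
    n = suc (suc k)
    h = n / 2
    IH = rec (m/n<m n 2 (s≤s (s≤s z≤n))) (m≥n⇒m/n>0 {n} {2} (s≤s (s≤s z≤n)))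
    n≡r+2h : n ≡ n % 2 + h * 2
    n≡r+2h = m≡m%n+[m/n]*n n 2
    open ≤-Reasoning
    lower : 2 ^ suc (L h) ≤ n
    lower = begin
      2 * 2 ^ L h   ≤⟨ *-monoʳ-≤ 2 (proj₁ IH) ⟩
      2 * h         ≡⟨ *-comm 2 h ⟩
      h * 2         ≤⟨ m≤n+m (h * 2) (n % 2) ⟩
      n % 2 + h * 2 ≡⟨ n≡r+2h ⟨
      n             ∎
    upper : n < 2 ^ suc (suc (L h))
    upper = begin-strict
      n             ≡⟨ n≡r+2h ⟩
      n % 2 + h * 2 <⟨ +-monoˡ-< (h * 2) (m%n<n n 2) ⟩
      2 + h * 2     ≡⟨ *-comm (suc h) 2 ⟩
      2 * suc h     ≤⟨ *-monoʳ-≤ 2 (proj₂ IH) ⟩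
      2 * 2 ^ suc (L h) ∎

L-[2n+1]≡L-[2n] : ∀ n → 1 ≤ n → L (2 * n + 1) ≡ L (2 * n)
L-[2n+1]≡L-[2n] n 1≤n = begin
  L (2 * n + 1)             ≡⟨ L-half (2 * n + 1) (≤-trans 2≤2n (m≤m+n (2 * n) 1)) ⟩
  suc (L ((2 * n + 1) / 2)) ≡⟨ cong (suc ∘ L) (trans ([2n+1]/2≡n n) (sym ([2n]/2≡n n))) ⟩
  suc (L ((2 * n) / 2))     ≡⟨ L-half (2 * n) 2≤2n ⟨
  L (2 * n)                 ∎
  where
  open ≡-Reasoning
  2≤2n : 2 ≤ 2 * n
  2≤2n = *-monoʳ-≤ 2 1≤n

[2n+1]/2^[1+i]≡[2n]/2^[1+i] : ∀ n i → (2 * n + 1) /2^ suc i ≡ (2 * n) /2^ suc i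
[2n+1]/2^[1+i]≡[2n]/2^[1+i] n i = begin
  (2 * n + 1) /2^ suc i     ≡⟨ /2^-suc (2 * n + 1) i ⟩
  ((2 * n + 1) / 2) /2^ i   ≡⟨ cong (_/2^ i) (trans ([2n+1]/2≡n n) (sym ([2n]/2≡n n))) ⟩
  ((2 * n) / 2) /2^ i       ≡⟨ /2^-suc (2 * n) i ⟨
  (2 * n) /2^ suc i         ∎
  where open ≡-Reasoning

sumBelow : ℕ → (ℕ → ℕ) → ℕ
sumBelow zero    g = 0
sumBelow (suc K) g = g 0 + sumBelow K (g ∘ suc)

sumBelow-cong : ∀ K {g h} → (∀ j → j < K → g j ≡ h j) → sumBelow K g ≡ sumBelow K h
sumBelow-cong zero    g≡h = refl
sumBelow-cong (suc K) g≡h = cong₂ _+_ (g≡h 0 (s≤s z≤n)) (sumBelow-cong K (λ j → g≡h (suc j) ∘ s≤s))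

sumBelow-+ : ∀ a b g → sumBelow (a + b) g ≡ sumBelow a g + sumBelow b (λ j → g (a + j))
sumBelow-+ zero    b g = refl
sumBelow-+ (suc a) b g = trans (cong (_+_ (g 0)) (sumBelow-+ a b (g ∘ suc))) (sym (+-assoc (g 0) _ _))

sumBelow-zero : ∀ K g → (∀ j → j < K → g j ≡ 0) → sumBelow K g ≡ 0
sumBelow-zero K g g≡0 = trans (sumBelow-cong K g≡0) (sumBelow-const K)
  where
  sumBelow-const : ∀ K → sumBelow K (λ _ → 0) ≡ 0
  sumBelow-const zero    = refl
  sumBelow-const (suc K) = sumBelow-const K

sumBelow-constant : ∀ K c → sumBelow K (λ _ → c) ≡ K * c
sumBelow-constant zero    c = refl
sumBelow-constant (suc K) c = cong (_+_ c) (sumBelow-constant K c)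

sumBelow-mono : ∀ K {g h} → (∀ j → j < K → g j ≤ h j) → sumBelow K g ≤ sumBelow K h
sumBelow-mono zero    g≤h = z≤n
sumBelow-mono (suc K) g≤h = +-mono-≤ (g≤h 0 (s≤s z≤n)) (sumBelow-mono K (λ j → g≤h (suc j) ∘ s≤s))

sumBelow-distrib : ∀ K g h → sumBelow K (λ j → g j + h j) ≡ sumBelow K g + sumBelow K h
sumBelow-distrib zero    g h = refl
sumBelow-distrib (suc K) g h =
  trans (cong (_+_ (g 0 + h 0)) (sumBelow-distrib K (g ∘ suc) (h ∘ suc))) (+-+-comm (g 0) (h 0) _ _)
  where
  +-+-comm : ∀ a b c d → a + b + (c + d) ≡ a + c + (b + d)
  +-+-comm = ℕ-solve-∀

sumBelow-∣ : ∀ {d} K g → (∀ j → j < K → d ∣ g j) → d ∣ sumBelow K g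
sumBelow-∣ {d} zero g d∣g = divides 0 (sym (*-zeroˡ d))
sumBelow-∣ {d} (suc K) g d∣g = ∣m∣n⇒∣m+n (d∣g 0 (s≤s z≤n)) (sumBelow-∣ K (g ∘ suc) (λ j j<K → d∣g (suc j) (s≤s j<K)))

sum-map-applyUpTo : ∀ (g f : ℕ → ℕ) K → sum (map g (applyUpTo f K)) ≡ sumBelow K (g ∘ f)
sum-map-applyUpTo g f zero    = refl
sum-map-applyUpTo g f (suc K) = cong (_+_ (g (f 0))) (sum-map-applyUpTo g (f ∘ suc) K)

prodDeg-applyUpTo : ∀ e (f : ℕ → ℕ) K → prodDeg e (applyUpTo f K) ≡ sumBelow K (λ j → e (f j) * 2 ^ f j)
prodDeg-applyUpTo e f zero    = refl
prodDeg-applyUpTo e f (suc K) = cong (_+_ (e (f 0) * 2 ^ f 0)) (prodDeg-applyUpTo e (f ∘ suc) K)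

numDeg : ℕ → ℕ
numDeg n = prodDeg (n /2^_) (upTo (suc (L n))) ∸ n

numDeg-sum : ∀ n → numDeg n ≡ sumBelow (L n) (λ j → n /2^ suc j * 2 ^ suc j)
numDeg-sum n = trans (cong (_∸ n) (cong₂ _+_ (trans (*-identityʳ (n /2^ 0)) (/2^-zero n))
                                             (prodDeg-applyUpTo (n /2^_) suc (L n))))
                     (m+n∸m≡n n _)

n<2^n : ∀ n → n < 2 ^ n
n<2^n zero    = s≤s z≤n
n<2^n (suc n) = subst₂ _<_ (+-comm n 1) (sym (cong (_+_ (2 ^ n)) (+-identityʳ (2 ^ n))))
                       (+-mono-<-≤ (n<2^n n) (m^n>0 2 n))

/2^-vanishes : ∀ n {j} → 1 ≤ n → L n < j → n /2^ j ≡ 0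
/2^-vanishes n {j} 1≤n L<j = m<n⇒m/n≡0 {{m^n≢0 2 j}} (<-≤-trans (proj₂ (L-bounds n 1≤n)) (^-monoʳ-≤ 2 L<j))

numDeg≡sumRange : ∀ n → 1 ≤ n → numDeg n ≡ sumRange 1 n (λ j → 2 ^ j * (n /2^ j))
numDeg≡sumRange n 1≤n = begin
  numDeg n                                      ≡⟨ numDeg-sum n ⟩
  sumBelow (L n) term                           ≡⟨ +-identityʳ _ ⟨
  sumBelow (L n) term + 0                       ≡⟨ cong (_+_ (sumBelow (L n) term)) tail≡0 ⟨
  sumBelow (L n) term + sumBelow (n ∸ L n) (λ j → term (L n + j)) ≡⟨ sumBelow-+ (L n) (n ∸ L n) term ⟨
  sumBelow (L n + (n ∸ L n)) term               ≡⟨ cong (λ K → sumBelow K term) (m+[n∸m]≡n L≤n) ⟩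
  sumBelow n term                               ≡⟨ sumBelow-cong n (λ j _ → *-comm (n /2^ suc j) (2 ^ suc j)) ⟩
  sumBelow n (λ j → 2 ^ suc j * (n /2^ suc j))  ≡⟨ sum-map-applyUpTo (λ j → 2 ^ suc j * (n /2^ suc j)) id n ⟨
  sumRange 1 n (λ j → 2 ^ j * (n /2^ j))        ∎
  where
  open ≡-Reasoning
  term = λ j → n /2^ suc j * 2 ^ suc j
  L≤n : L n ≤ n
  L≤n = ≤-trans (<⇒≤ (n<2^n (L n))) (proj₁ (L-bounds n 1≤n))
  tail≡0 : sumBelow (n ∸ L n) (λ j → term (L n + j)) ≡ 0
  tail≡0 = sumBelow-zero (n ∸ L n) (λ j → term (L n + j))
             (λ j _ → cong (_* 2 ^ suc (L n + j)) (/2^-vanishes n 1≤n (s≤s (m≤m+n (L n) j))))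

numDeg-even : ∀ n → 2 ∣ numDeg n
numDeg-even n = subst (2 ∣_) (sym (numDeg-sum n)) (sumBelow-∣ (L n) _ (λ j _ → 2∣term j))
  where
  2∣term : ∀ j → 2 ∣ n /2^ suc j * 2 ^ suc j
  2∣term j = divides (n /2^ suc j * 2 ^ j) (solve-∀′ (n /2^ suc j) (2 ^ j))
    where
    solve-∀′ : ∀ a p → a * (2 * p) ≡ a * p * 2
    solve-∀′ = ℕ-solve-∀

numDeg-lower : ∀ n → 1 ≤ n → 2 ^ L n * L n ≤ numDeg n
numDeg-lower n 1≤n = subst₂ _≤_ (trans (sumBelow-constant (L n) (2 ^ L n)) (*-comm (L n) (2 ^ L n))) (sym (numDeg-sum n))
  (sumBelow-mono (L n) term≥)
  where
  open ≤-Reasoning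
  term≥ : ∀ j → j < L n → 2 ^ L n ≤ n /2^ suc j * 2 ^ suc j
  term≥ j j<L = begin
    2 ^ L n                    ≡⟨ 2^L≡ ⟩
    2 ^ r * 2 ^ suc j          ≤⟨ *-monoˡ-≤ (2 ^ suc j) 2^r≤ ⟩
    n /2^ suc j * 2 ^ suc j    ∎
    where
    r = L n ∸ suc j
    2^L≡ : 2 ^ L n ≡ 2 ^ r * 2 ^ suc j
    2^L≡ = trans (cong (2 ^_) (trans (sym (m+[n∸m]≡n j<L)) (+-comm (suc j) r))) (^-distribˡ-+-* 2 r (suc j))
    2^r≤ : 2 ^ r ≤ n /2^ suc j
    2^r≤ = subst (_≤ n /2^ suc j) (m*n/n≡m (2 ^ r) (2 ^ suc j) {{m^n≢0 2 (suc j)}})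
             (/-monoˡ-≤ (2 ^ suc j) {{m^n≢0 2 (suc j)}} (subst (_≤ n) 2^L≡ (proj₁ (L-bounds n 1≤n))))

numDeg-upper : ∀ n → numDeg n ≤ n * L n
numDeg-upper n = subst₂ _≤_ (sym (numDeg-sum n)) (trans (sumBelow-constant (L n) n) (*-comm (L n) n))
  (sumBelow-mono (L n) (λ j _ → m/n*n≤m n (2 ^ suc j) {{m^n≢0 2 (suc j)}}))

Odd : ℕ → Set
Odd o = ∃[ t ] o ≡ suc (2 * t)

Odd-* : ∀ {a b} → Odd a → Odd b → Odd (a * b)
Odd-* (s , refl) (t , refl) = s + t + 2 * s * t , expand s t
  where
  expand : ∀ s t → suc (2 * s) * suc (2 * t) ≡ suc (2 * (s + t + 2 * s * t))
  expand = ℕ-solve-∀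

val₂-2^*odd : ∀ v {o} → Odd o → val₂ (2 ^ v * o) ≡ v
val₂-2^*odd v {o} (t , refl) = enough-fuel (2 ^ v * o) v v<2^v*o
  where
  2^s*o≢0 : ∀ s → 2 ^ s * o ≢ 0
  2^s*o≢0 s = ≢-nonZero⁻¹ (2 ^ s * o) {{m*n≢0 (2 ^ s) o {{m^n≢0 2 s}}}}
  enough-fuel : ∀ f s → s < f → val2-go f (2 ^ s * o) ≡ s
  enough-fuel (suc f) zero    _ with 2 ^ 0 * o ≟ 0
  ... | yes o≡0 = ⊥-elim (2^s*o≢0 0 o≡0)
  ... | no _ with (2 ^ 0 * o) % 2 ≟ 0
  ...   | no _      = refl
  ...   | yes even  = ⊥-elim (1+n≢0 (trans (sym odd%2) (trans (cong (_% 2) (sym (+-identityʳ o))) even)))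
    where
    odd%2 : suc (2 * t) % 2 ≡ 1
    odd%2 = trans (cong (λ m → suc m % 2) (*-comm 2 t)) ([m+kn]%n≡m%n 1 t 2)
  enough-fuel (suc f) (suc s) (s≤s s<f) with 2 ^ suc s * o ≟ 0
  ... | yes 2^s*o≡0 = ⊥-elim (2^s*o≢0 (suc s) 2^s*o≡0)
  ... | no _ with (2 ^ suc s * o) % 2 ≟ 0
  ...   | yes _ = cong suc (trans (cong (val2-go f) halve) (enough-fuel f s s<f))
    where
    halve : (2 ^ suc s * o) / 2 ≡ 2 ^ s * o
    halve = trans (cong (_/ 2) (*-assoc 2 (2 ^ s) o)) ([2n]/2≡n (2 ^ s * o))
  ...   | no odd = ⊥-elim (odd (trans (cong (_% 2) (trans (*-assoc 2 (2 ^ s) o) (*-comm 2 (2 ^ s * o))))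
                                      (m*n%n≡0 (2 ^ s * o) 2)))
  v<2^v*o : v < 2 ^ v * o
  v<2^v*o = <-≤-trans (n<2^n v) (m≤m*n (2 ^ v) (suc (2 * t)))

n%2≡0⊎n%2≡1 : ∀ n → n % 2 ≡ 0 ⊎ n % 2 ≡ 1
n%2≡0⊎n%2≡1 n with n % 2 | m%n<n n 2
... | zero        | _ = inj₁ refl
... | suc zero    | _ = inj₂ refl
... | suc (suc _) | s≤s (s≤s ())

n≡2^val₂*odd : ∀ n → 1 ≤ n → ∃[ o ] Odd o × n ≡ 2 ^ val₂ n * o
n≡2^val₂*odd n 1≤n with <-rec (λ n → 1 ≤ n → ∃[ v ] ∃[ o ] Odd o × n ≡ 2 ^ v * o) decompose n 1≤n
  where
  decompose : ∀ n → (∀ {m} → m < n → 1 ≤ m → ∃[ v ] ∃[ o ] Odd o × m ≡ 2 ^ v * o) →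
              1 ≤ n → ∃[ v ] ∃[ o ] Odd o × n ≡ 2 ^ v * o
  decompose n rec 1≤n with n%2≡0⊎n%2≡1 n
  ... | inj₂ n%2≡1 = 0 , n , (n / 2 , trans (m≡m%n+[m/n]*n n 2) (cong₂ _+_ n%2≡1 (*-comm (n / 2) 2))) ,
                     sym (+-identityʳ n)
  ... | inj₁ n%2≡0 with rec (m/n<m n 2 {{>-nonZero 1≤n}} (s≤s (s≤s z≤n))) 1≤n/2
    where
    1≤n/2 : 1 ≤ n / 2
    1≤n/2 = n≢0⇒n>0 (λ n/2≡0 → ≢-nonZero⁻¹ n {{>-nonZero 1≤n}} (trans n≡2*[n/2] (cong (2 *_) n/2≡0)))
      where
      n≡2*[n/2] : n ≡ 2 * (n / 2)
      n≡2*[n/2] = trans (m≡m%n+[m/n]*n n 2) (trans (cong (_+ n / 2 * 2) n%2≡0) (*-comm (n / 2) 2))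
  ... | v , o , odd , n/2≡2^v*o = suc v , o , odd , (begin
    n               ≡⟨ m≡m%n+[m/n]*n n 2 ⟩
    n % 2 + n / 2 * 2 ≡⟨ cong₂ _+_ n%2≡0 (*-comm (n / 2) 2) ⟩
    2 * (n / 2)     ≡⟨ cong (2 *_) n/2≡2^v*o ⟩
    2 * (2 ^ v * o) ≡⟨ *-assoc 2 (2 ^ v) o ⟨
    2 ^ suc v * o   ∎)
    where open ≡-Reasoning
... | v , o , odd , n≡2^v*o = o , odd , subst (λ w → n ≡ 2 ^ w * o) (sym val₂n≡v) n≡2^v*o
  where
  val₂n≡v : val₂ n ≡ v
  val₂n≡v = trans (cong val₂ n≡2^v*o) (val₂-2^*odd v odd)

numDeg+remainders : ∀ n → 1 ≤ n → numDeg n + sumRange (val₂ n + 1) (L n) (λ j → n %2^ j) ≡ n * L n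
numDeg+remainders n 1≤n with n≡2^val₂*odd n 1≤n
... | o , odd , n≡2^v*o = begin
  numDeg n + sumRange (v + 1) K (n %2^_)                ≡⟨ cong₂ _+_ (numDeg-sum n) remainders ⟩
  sumBelow K quotientPart + sumBelow K remainder        ≡⟨ sumBelow-distrib K quotientPart remainder ⟨
  sumBelow K (λ j → quotientPart j + remainder j)       ≡⟨ sumBelow-cong K (λ j _ → division j) ⟩
  sumBelow K (λ _ → n)                                  ≡⟨ sumBelow-constant K n ⟩
  K * n                                                 ≡⟨ *-comm K n ⟩
  n * K                                                 ∎
  where
  open ≡-Reasoning
  v = val₂ n
  K = L n
  quotientPart = λ j → n /2^ suc j * 2 ^ suc j
  remainder    = λ j → n %2^ suc j
  division : ∀ j → quotientPart j + remainder j ≡ n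
  division j = trans (+-comm (quotientPart j) (remainder j)) (sym (m≡m%n+[m/n]*n n (2 ^ suc j) {{m^n≢0 2 (suc j)}}))
  2^v∣n : 2 ^ v ∣ n
  2^v∣n = divides o (trans n≡2^v*o (*-comm (2 ^ v) o))
  v≤K : v ≤ K
  v≤K = ≮⇒≥ (λ K<v → <-irrefl refl (<-≤-trans (proj₂ (L-bounds n 1≤n))
                                      (≤-trans (^-monoʳ-≤ 2 K<v) (∣⇒≤ {{>-nonZero 1≤n}} 2^v∣n))))
  remainder≡0 : ∀ j → j < v → remainder j ≡ 0
  remainder≡0 j j<v = n∣m⇒m%n≡0 n (2 ^ suc j) {{m^n≢0 2 (suc j)}} (∣-trans 2^[1+j]∣2^v 2^v∣n)
    where
    2^[1+j]∣2^v : 2 ^ suc j ∣ 2 ^ v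
    2^[1+j]∣2^v = divides (2 ^ (v ∸ suc j))
      (trans (cong (2 ^_) (sym (m∸n+n≡m j<v))) (^-distribˡ-+-* 2 (v ∸ suc j) (suc j)))
  remainders : sumRange (v + 1) K (n %2^_) ≡ sumBelow K remainder
  remainders = begin
    sum (map (λ i → n %2^ (v + 1 + i)) (upTo (suc K ∸ (v + 1))))
      ≡⟨ cong (λ w → sum (map (λ i → n %2^ (w + i)) (upTo (suc K ∸ w)))) (+-comm v 1) ⟩
    sum (map (λ i → n %2^ suc (v + i)) (upTo (K ∸ v)))
      ≡⟨ sum-map-applyUpTo (λ i → n %2^ suc (v + i)) id (K ∸ v) ⟩
    sumBelow (K ∸ v) (λ i → remainder (v + i))
      ≡⟨ cong (_+ sumBelow (K ∸ v) (λ i → remainder (v + i))) (sumBelow-zero v remainder remainder≡0) ⟨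
    sumBelow v remainder + sumBelow (K ∸ v) (λ i → remainder (v + i))
      ≡⟨ sumBelow-+ v (K ∸ v) remainder ⟨
    sumBelow (v + (K ∸ v)) remainder
      ≡⟨ cong (λ M → sumBelow M remainder) (m+[n∸m]≡n v≤K) ⟩
    sumBelow K remainder ∎

legendre₂ : ℕ → ℕ
legendre₂ n = sumBelow (L n) (λ j → n /2^ suc j)

legendre₂-half : ∀ n → 2 ≤ n → legendre₂ n ≡ n / 2 + legendre₂ (n / 2)
legendre₂-half n 2≤n = trans (cong (λ K → sumBelow K (λ j → n /2^ suc j)) (L-half n 2≤n))
  (cong (_+_ (n / 2)) (sumBelow-cong (L (n / 2)) (λ j _ → /2^-suc n (suc j))))

!-double : ∀ k → (∃[ o ] Odd o × (2 * k) ! ≡ 2 ^ k * k ! * o) × (∃[ o ] Odd o × suc (2 * k) ! ≡ 2 ^ k * k ! * o)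
!-double zero    = (1 , (0 , refl) , refl) , (1 , (0 , refl) , refl)
!-double (suc k) with !-double k
... | _ , (o , odd , [2k+1]!≡) = (o , odd , [2k+2]!≡) , (suc (2 * suc k) * o , Odd-* (suc k , refl) odd , [2k+3]!≡)
  where
  [2k+2]!≡ : (2 * suc k) ! ≡ 2 ^ suc k * suc k ! * o
  [2k+2]!≡ = trans (cong _! (2*[1+k]≡2+2k k)) (trans (cong (suc (suc (2 * k)) *_) [2k+1]!≡) (regroup k (2 ^ k) (k !) o))
    where
    2*[1+k]≡2+2k : ∀ k → 2 * suc k ≡ suc (suc (2 * k))
    2*[1+k]≡2+2k = ℕ-solve-∀
    regroup : ∀ k P F o → suc (suc (2 * k)) * (P * F * o) ≡ 2 * P * (suc k * F) * o
    regroup = ℕ-solve-∀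
  [2k+3]!≡ : suc (2 * suc k) ! ≡ 2 ^ suc k * suc k ! * (suc (2 * suc k) * o)
  [2k+3]!≡ = trans (cong (suc (2 * suc k) *_) [2k+2]!≡) (regroup (2 * suc k) (2 ^ suc k) (suc k !) o)
    where
    regroup : ∀ m P F o → suc m * (P * F * o) ≡ P * F * (suc m * o)
    regroup = ℕ-solve-∀

!-half : ∀ n → ∃[ o ] Odd o × n ! ≡ 2 ^ (n / 2) * (n / 2) ! * o
!-half n with n%2≡0⊎n%2≡1 n
... | inj₁ n%2≡0 = subst (λ m → ∃[ o ] Odd o × m ! ≡ 2 ^ (n / 2) * (n / 2) ! * o) (sym n≡2k) (proj₁ (!-double (n / 2)))
  where
  n≡2k : n ≡ 2 * (n / 2)
  n≡2k = trans (m≡m%n+[m/n]*n n 2) (trans (cong (_+ n / 2 * 2) n%2≡0) (*-comm (n / 2) 2))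
... | inj₂ n%2≡1 = subst (λ m → ∃[ o ] Odd o × m ! ≡ 2 ^ (n / 2) * (n / 2) ! * o) (sym n≡2k+1) (proj₂ (!-double (n / 2)))
  where
  n≡2k+1 : n ≡ suc (2 * (n / 2))
  n≡2k+1 = trans (m≡m%n+[m/n]*n n 2) (trans (cong (_+ n / 2 * 2) n%2≡1) (cong suc (*-comm (n / 2) 2)))

!≡2^legendre₂*odd : ∀ n → ∃[ o ] Odd o × n ! ≡ 2 ^ legendre₂ n * o
!≡2^legendre₂*odd = <-rec (λ n → ∃[ o ] Odd o × n ! ≡ 2 ^ legendre₂ n * o) split
  where
  split : ∀ n → (∀ {m} → m < n → ∃[ o ] Odd o × m ! ≡ 2 ^ legendre₂ m * o) → ∃[ o ] Odd o × n ! ≡ 2 ^ legendre₂ n * o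
  split zero          rec = 1 , (0 , refl) , refl
  split (suc zero)    rec = 1 , (0 , refl) , refl
  split n@(suc (suc _)) rec with !-half n | rec {n / 2} (m/n<m n 2 (s≤s (s≤s z≤n)))
  ... | o₁ , odd₁ , n!≡ | o₂ , odd₂ , [n/2]!≡ = o₂ * o₁ , Odd-* odd₂ odd₁ , (begin
    n !                                          ≡⟨ n!≡ ⟩
    2 ^ (n / 2) * (n / 2) ! * o₁                 ≡⟨ cong (λ F → 2 ^ (n / 2) * F * o₁) [n/2]!≡ ⟩
    2 ^ (n / 2) * (2 ^ legendre₂ (n / 2) * o₂) * o₁ ≡⟨ regroup (2 ^ (n / 2)) (2 ^ legendre₂ (n / 2)) o₂ o₁ ⟩
    2 ^ (n / 2) * 2 ^ legendre₂ (n / 2) * (o₂ * o₁) ≡⟨ cong (_* (o₂ * o₁)) (^-distribˡ-+-* 2 (n / 2) _) ⟨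
    2 ^ (n / 2 + legendre₂ (n / 2)) * (o₂ * o₁)  ≡⟨ cong (λ e → 2 ^ e * (o₂ * o₁)) (legendre₂-half n (s≤s (s≤s z≤n))) ⟨
    2 ^ legendre₂ n * (o₂ * o₁)                  ∎)
    where
    open ≡-Reasoning
    regroup : ∀ P Q o₂ o₁ → P * (Q * o₂) * o₁ ≡ P * Q * (o₂ * o₁)
    regroup = ℕ-solve-∀

val₂-! : ∀ n → val₂ (n !) ≡ legendre₂ n
val₂-! n with !≡2^legendre₂*odd n
... | o , odd , n!≡ = trans (cong val₂ n!≡) (val₂-2^*odd (legendre₂ n) odd)

module Evaluation (R : CommutativeSemiring 0ℓ 0ℓ) where

  open CommutativeSemiring R
    using (Carrier; _≈_; 0#; 1#; setoid; semiring; zeroˡ; zeroʳ; distribˡ; distribʳ)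
    renaming ( _+_ to _⊕_; _*_ to _⊗_; refl to ≈-refl; sym to ≈-sym; trans to ≈-trans
             ; +-cong to ⊕-cong; *-cong to ⊗-cong; *-congˡ to ⊗-congˡ; *-assoc to ⊗-assoc; *-comm to ⊗-comm
             ; +-assoc to ⊕-assoc; +-comm to ⊕-comm; +-identityˡ to ⊕-identityˡ; +-identityʳ to ⊕-identityʳ)
  open import Algebra.Properties.Semiring.Exp semiring using (^-congˡ) renaming (_^_ to _^ʳ_)
  open import Relation.Binary.Reasoning.Setoid setoid
  open FiniteSums R

  module At (ι : ℤ → Carrier)
            (ι-+ : ∀ a c → ι (a ℤ.+ c) ≈ ι a ⊕ ι c) (ι-* : ∀ a c → ι (a ℤ.* c) ≈ ι a ⊗ ι c)
            (ι-0 : ι (+ 0) ≈ 0#) (ι-1 : ι (+ 1) ≈ 1#) (x : Carrier) where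

    evalAt : Poly → Carrier
    evalAt p = foldr (λ a acc → ι a ⊕ x ⊗ acc) 0# p

    evalAt-+ₚ : ∀ p q → evalAt (p +ₚ q) ≈ evalAt p ⊕ evalAt q
    evalAt-+ₚ []      q       = ≈-sym (⊕-identityˡ _)
    evalAt-+ₚ (a ∷ p) []      = ≈-sym (⊕-identityʳ _)
    evalAt-+ₚ (a ∷ p) (c ∷ q) = begin
      ι (a ℤ.+ c) ⊕ x ⊗ evalAt (p +ₚ q)             ≈⟨ ⊕-cong (ι-+ a c) (⊗-congˡ (evalAt-+ₚ p q)) ⟩
      (ι a ⊕ ι c) ⊕ x ⊗ (evalAt p ⊕ evalAt q)       ≈⟨ ⊕-cong ≈-refl (distribˡ x _ _) ⟩
      (ι a ⊕ ι c) ⊕ (x ⊗ evalAt p ⊕ x ⊗ evalAt q)   ≈⟨ ⊕-interchange (ι a) (ι c) _ _ ⟩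
      (ι a ⊕ x ⊗ evalAt p) ⊕ (ι c ⊕ x ⊗ evalAt q)   ∎
      where
      ⊕-interchange : ∀ a b c d → (a ⊕ b) ⊕ (c ⊕ d) ≈ (a ⊕ c) ⊕ (b ⊕ d)
      ⊕-interchange a b c d = begin
        (a ⊕ b) ⊕ (c ⊕ d) ≈⟨ ⊕-assoc a b (c ⊕ d) ⟩
        a ⊕ (b ⊕ (c ⊕ d)) ≈⟨ ⊕-cong ≈-refl (⊕-assoc b c d) ⟨
        a ⊕ ((b ⊕ c) ⊕ d) ≈⟨ ⊕-cong ≈-refl (⊕-cong (⊕-comm b c) ≈-refl) ⟩
        a ⊕ ((c ⊕ b) ⊕ d) ≈⟨ ⊕-cong ≈-refl (⊕-assoc c b d) ⟩
        a ⊕ (c ⊕ (b ⊕ d)) ≈⟨ ⊕-assoc a c (b ⊕ d) ⟨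
        (a ⊕ c) ⊕ (b ⊕ d) ∎

    evalAt-scale : ∀ a q → evalAt (map (a ℤ.*_) q) ≈ ι a ⊗ evalAt q
    evalAt-scale a []      = ≈-sym (zeroʳ _)
    evalAt-scale a (c ∷ q) = begin
      ι (a ℤ.* c) ⊕ x ⊗ evalAt (map (a ℤ.*_) q) ≈⟨ ⊕-cong (ι-* a c) (⊗-congˡ (evalAt-scale a q)) ⟩
      ι a ⊗ ι c ⊕ x ⊗ (ι a ⊗ evalAt q)          ≈⟨ ⊕-cong ≈-refl (x*[a*q]≈a*[x*q]) ⟩
      ι a ⊗ ι c ⊕ ι a ⊗ (x ⊗ evalAt q)          ≈⟨ distribˡ (ι a) _ _ ⟨
      ι a ⊗ (ι c ⊕ x ⊗ evalAt q)                ∎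
      where
      x*[a*q]≈a*[x*q] : x ⊗ (ι a ⊗ evalAt q) ≈ ι a ⊗ (x ⊗ evalAt q)
      x*[a*q]≈a*[x*q] = ≈-trans (≈-sym (⊗-assoc x _ _)) (≈-trans (⊗-cong (⊗-comm x (ι a)) ≈-refl) (⊗-assoc (ι a) x _))

    evalAt-*ₚ : ∀ p q → evalAt (p *ₚ q) ≈ evalAt p ⊗ evalAt q
    evalAt-*ₚ []      q = ≈-sym (zeroˡ _)
    evalAt-*ₚ (a ∷ p) q = begin
      evalAt (map (a ℤ.*_) q +ₚ (+ 0 ∷ p *ₚ q))            ≈⟨ evalAt-+ₚ (map (a ℤ.*_) q) (+ 0 ∷ p *ₚ q) ⟩
      evalAt (map (a ℤ.*_) q) ⊕ (ι (+ 0) ⊕ x ⊗ evalAt (p *ₚ q))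
        ≈⟨ ⊕-cong (evalAt-scale a q) (⊕-cong ι-0 (⊗-congˡ (evalAt-*ₚ p q))) ⟩
      ι a ⊗ evalAt q ⊕ (0# ⊕ x ⊗ (evalAt p ⊗ evalAt q))
        ≈⟨ ⊕-cong ≈-refl (≈-trans (⊕-identityˡ _) (≈-sym (⊗-assoc _ _ _))) ⟩
      ι a ⊗ evalAt q ⊕ (x ⊗ evalAt p) ⊗ evalAt q           ≈⟨ distribʳ _ _ _ ⟨
      (ι a ⊕ x ⊗ evalAt p) ⊗ evalAt q                       ∎

    evalAt-oneₚ : evalAt oneₚ ≈ 1#
    evalAt-oneₚ = ≈-trans (⊕-cong ι-1 (zeroʳ x)) (⊕-identityʳ 1#)

    evalAt-^ₚ : ∀ p a → evalAt (p ^ₚ a) ≈ evalAt p ^ʳ a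
    evalAt-^ₚ p zero    = evalAt-oneₚ
    evalAt-^ₚ p (suc a) = ≈-trans (evalAt-*ₚ p (p ^ₚ a)) (⊗-congˡ (evalAt-^ₚ p a))

    evalAt-x^ : ∀ m → evalAt (monoₚ m) ≈ x ^ʳ m
    evalAt-x^ zero    = evalAt-oneₚ
    evalAt-x^ (suc m) = ≈-trans (⊕-cong ι-0 (⊗-congˡ (evalAt-x^ m))) (⊕-identityˡ _)

    evalAt-prodₚ : ∀ e l → evalAt (prodₚ e l) ≈ ∏ l (λ i → (1# ⊕ x ^ʳ (2 ^ i)) ^ʳ e i)
    evalAt-prodₚ e []      = evalAt-oneₚ
    evalAt-prodₚ e (i ∷ l) = ≈-trans (evalAt-*ₚ (1+x^ (2 ^ i) ^ₚ e i) (prodₚ e l))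
      (⊗-cong (≈-trans (evalAt-^ₚ (1+x^ (2 ^ i)) (e i))
                       (^-congˡ (e i) (≈-trans (evalAt-+ₚ oneₚ (monoₚ (2 ^ i))) (⊕-cong evalAt-oneₚ (evalAt-x^ (2 ^ i))))))
              (evalAt-prodₚ e l))

    evalAt-num𝓑 : ∀ n →
      evalAt (num𝓑 n) ≈ ∑ (𝓑 n) (λ ms → ∏ (upTo (suc (L n))) (λ i → (1# ⊕ x ^ʳ (2 ^ i)) ^ʳ hExp n ms i))
    evalAt-num𝓑 n = ≈-trans (evalAt-∑ (𝓑 n)) (∑-cong (𝓑 n) (λ ms _ → evalAt-prodₚ (hExp n ms) (upTo (suc (L n)))))
      where
      evalAt-∑ : ∀ l → evalAt (foldr (λ ms acc → h𝓑 n ms +ₚ acc) [] l) ≈ ∑ l (evalAt ∘ h𝓑 n)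
      evalAt-∑ []       = ≈-refl
      evalAt-∑ (ms ∷ l) = ≈-trans (evalAt-+ₚ (h𝓑 n ms) _) (⊕-cong ≈-refl (evalAt-∑ l))

-- Divisibility by 1 + x + x²

-- (a , b) stands for a + bω, where ω² = -1 - ω.
ℤ[ω] : Set
ℤ[ω] = ℤ × ℤ

infixl 6 _+ω_
infixl 7 _*ω_

_+ω_ : ℤ[ω] → ℤ[ω] → ℤ[ω]
(a , b) +ω (c , d) = a ℤ.+ c , b ℤ.+ d

_*ω_ : ℤ[ω] → ℤ[ω] → ℤ[ω]
(a , b) *ω (c , d) = a ℤ.* c ℤ.- b ℤ.* d , a ℤ.* d ℤ.+ b ℤ.* c ℤ.- b ℤ.* d

0ω 1ω ω : ℤ[ω]
0ω = + 0 , + 0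
1ω = + 1 , + 0
ω  = + 0 , + 1

ℤ[ω]-commutativeSemiring : CommutativeSemiring 0ℓ 0ℓ
ℤ[ω]-commutativeSemiring = record
  { _≈_ = _≡_ ; _+_ = _+ω_ ; _*_ = _*ω_ ; 0# = 0ω ; 1# = 1ω
  ; isCommutativeSemiring = isCommutativeSemiringˡ record
    { +-isCommutativeMonoid = isCommutativeMonoidˡ record
      { isSemigroup = record { isMagma = record { isEquivalence = isEquivalence ; ∙-cong = cong₂ _+ω_ }
                             ; assoc = +ω-assoc }
      ; identityˡ   = +ω-identityˡ
      ; comm        = +ω-comm
      }
    ; *-isCommutativeMonoid = isCommutativeMonoidˡ record
      { isSemigroup = record { isMagma = record { isEquivalence = isEquivalence ; ∙-cong = cong₂ _*ω_ }
                             ; assoc = *ω-assoc }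
      ; identityˡ   = *ω-identityˡ
      ; comm        = *ω-comm
      }
    ; distribʳ = *ω-distribʳ
    ; zeroˡ    = *ω-zeroˡ
    }
  }
  where
  open import Algebra.Structures.Biased {A = ℤ[ω]} _≡_ using (isCommutativeSemiringˡ; isCommutativeMonoidˡ)
  +ω-assoc : ∀ x y z → (x +ω y) +ω z ≡ x +ω (y +ω z)
  +ω-assoc (a , b) (c , d) (e , f) = cong₂ _,_ (ℤP.+-assoc a c e) (ℤP.+-assoc b d f)
  +ω-identityˡ : ∀ x → 0ω +ω x ≡ x
  +ω-identityˡ (a , b) = cong₂ _,_ (ℤP.+-identityˡ a) (ℤP.+-identityˡ b)
  +ω-comm : ∀ x y → x +ω y ≡ y +ω x
  +ω-comm (a , b) (c , d) = cong₂ _,_ (ℤP.+-comm a c) (ℤP.+-comm b d)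
  *ω-assoc : ∀ x y z → (x *ω y) *ω z ≡ x *ω (y *ω z)
  *ω-assoc (a , b) (c , d) (e , f) = cong₂ _,_ (re a b c d e f) (im a b c d e f)
    where
    re : ∀ a b c d e f → (a ℤ.* c ℤ.- b ℤ.* d) ℤ.* e ℤ.- (a ℤ.* d ℤ.+ b ℤ.* c ℤ.- b ℤ.* d) ℤ.* f
                       ≡ a ℤ.* (c ℤ.* e ℤ.- d ℤ.* f) ℤ.- b ℤ.* (c ℤ.* f ℤ.+ d ℤ.* e ℤ.- d ℤ.* f)
    re = solve-∀
    im : ∀ a b c d e f → (a ℤ.* c ℤ.- b ℤ.* d) ℤ.* f ℤ.+ (a ℤ.* d ℤ.+ b ℤ.* c ℤ.- b ℤ.* d) ℤ.* e
                           ℤ.- (a ℤ.* d ℤ.+ b ℤ.* c ℤ.- b ℤ.* d) ℤ.* f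
                       ≡ a ℤ.* (c ℤ.* f ℤ.+ d ℤ.* e ℤ.- d ℤ.* f) ℤ.+ b ℤ.* (c ℤ.* e ℤ.- d ℤ.* f)
                           ℤ.- b ℤ.* (c ℤ.* f ℤ.+ d ℤ.* e ℤ.- d ℤ.* f)
    im = solve-∀
  *ω-identityˡ : ∀ x → 1ω *ω x ≡ x
  *ω-identityˡ (a , b) = cong₂ _,_ (re a b) (im a b)
    where
    re : ∀ a b → + 1 ℤ.* a ℤ.- + 0 ℤ.* b ≡ a
    re = solve-∀
    im : ∀ a b → + 1 ℤ.* b ℤ.+ + 0 ℤ.* a ℤ.- + 0 ℤ.* b ≡ b
    im = solve-∀
  *ω-comm : ∀ x y → x *ω y ≡ y *ω x
  *ω-comm (a , b) (c , d) = cong₂ _,_ (re a b c d) (im a b c d)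
    where
    re : ∀ a b c d → a ℤ.* c ℤ.- b ℤ.* d ≡ c ℤ.* a ℤ.- d ℤ.* b
    re = solve-∀
    im : ∀ a b c d → a ℤ.* d ℤ.+ b ℤ.* c ℤ.- b ℤ.* d ≡ c ℤ.* b ℤ.+ d ℤ.* a ℤ.- d ℤ.* b
    im = solve-∀
  *ω-distribʳ : ∀ x y z → (y +ω z) *ω x ≡ y *ω x +ω z *ω x
  *ω-distribʳ (a , b) (c , d) (e , f) = cong₂ _,_ (re a b c d e f) (im a b c d e f)
    where
    re : ∀ a b c d e f → (c ℤ.+ e) ℤ.* a ℤ.- (d ℤ.+ f) ℤ.* b ≡ (c ℤ.* a ℤ.- d ℤ.* b) ℤ.+ (e ℤ.* a ℤ.- f ℤ.* b)
    re = solve-∀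
    im : ∀ a b c d e f → (c ℤ.+ e) ℤ.* b ℤ.+ (d ℤ.+ f) ℤ.* a ℤ.- (d ℤ.+ f) ℤ.* b
                       ≡ (c ℤ.* b ℤ.+ d ℤ.* a ℤ.- d ℤ.* b) ℤ.+ (e ℤ.* b ℤ.+ f ℤ.* a ℤ.- f ℤ.* b)
    im = solve-∀
  *ω-zeroˡ : ∀ x → 0ω *ω x ≡ 0ω
  *ω-zeroˡ (a , b) = cong₂ _,_ (re a b) (im a b)
    where
    re : ∀ a b → + 0 ℤ.* a ℤ.- + 0 ℤ.* b ≡ + 0
    re = solve-∀
    im : ∀ a b → + 0 ℤ.* b ℤ.+ + 0 ℤ.* a ℤ.- + 0 ℤ.* b ≡ + 0
    im = solve-∀

ι : ℤ → ℤ[ω]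
ι a = a , + 0

ι-* : ∀ a c → ι (a ℤ.* c) ≡ ι a *ω ι c
ι-* a c = cong₂ _,_ (re a c) (im a c)
  where
  re : ∀ a c → a ℤ.* c ≡ a ℤ.* c ℤ.- + 0 ℤ.* + 0
  re = solve-∀
  im : ∀ a c → + 0 ≡ a ℤ.* + 0 ℤ.+ + 0 ℤ.* c ℤ.- + 0 ℤ.* + 0
  im = solve-∀

1+x+x² : Poly
1+x+x² = + 1 ∷ + 1 ∷ + 1 ∷ []

mul1+x+x² : (ℕ → ℤ) → ℕ → ℤ
mul1+x+x² c k = c k ℤ.+ shift c k ℤ.+ shift (shift c) k

coeff-1+x+x²-*ₚ : ∀ q k → coeff (1+x+x² *ₚ q) k ≡ mul1+x+x² (coeff q) k
coeff-1+x+x²-*ₚ q k = begin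
  coeff (1+x+x² *ₚ q) k
    ≡⟨ coeff-∷-*ₚ (+ 1) (+ 1 ∷ + 1 ∷ []) q k ⟩
  + 1 ℤ.* coeff q k ℤ.+ shift (coeff ((+ 1 ∷ + 1 ∷ []) *ₚ q)) k
    ≡⟨ cong₂ ℤ._+_ (ℤP.*-identityˡ (coeff q k)) (shift-cong (λ j → trans (coeff-∷-*ₚ (+ 1) (+ 1 ∷ []) q j)
         (cong₂ ℤ._+_ (ℤP.*-identityˡ (coeff q j)) (shift-cong (coeff-oneₚ-*ₚ q) j))) k) ⟩
  coeff q k ℤ.+ shift (λ j → coeff q j ℤ.+ shift (coeff q) j) k
    ≡⟨ cong (ℤ._+_ (coeff q k)) (shift-+ (coeff q) (shift (coeff q)) k) ⟩
  coeff q k ℤ.+ (shift (coeff q) k ℤ.+ shift (shift (coeff q)) k)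
    ≡⟨ ℤP.+-assoc (coeff q k) _ _ ⟨
  mul1+x+x² (coeff q) k ∎
  where open ≡-Reasoning

-- ω^(2^t) depends only on the parity of t, as ω⁴ = ω.
ω^2^ : ℕ → ℤ[ω]
ω^2^ zero          = ω
ω^2^ (suc zero)    = -[1+ 0 ] , -[1+ 0 ]
ω^2^ (suc (suc t)) = ω^2^ t

ω^2^-square : ∀ t → ω^2^ t *ω ω^2^ t ≡ ω^2^ (suc t)
ω^2^-square zero          = refl
ω^2^-square (suc zero)    = refl
ω^2^-square (suc (suc t)) = ω^2^-square t

U : ℕ → ℤ[ω]
U t = 1ω +ω ω^2^ t

-- 1 + ω^(2^t) = -ω^(2^(t+1)), so its square is -(1 + ω^(2^(t+1))).
U-square : ∀ t → U t *ω U t +ω U (suc t) ≡ 0ω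
U-square zero          = refl
U-square (suc zero)    = refl
U-square (suc (suc t)) = U-square t

tailBounds-half : ∀ N → 2 ≤ N → tailBounds N ≡ bounds (N / 2)
tailBounds-half N 2≤N = begin
  map (N /2^_) (applyUpTo suc (L N))             ≡⟨ cong (λ K → map (N /2^_) (applyUpTo suc K)) (L-half N 2≤N) ⟩
  map (N /2^_) (applyUpTo suc (suc (L (N / 2)))) ≡⟨ cong (map (N /2^_)) (map-upTo suc _) ⟨
  map (N /2^_) (map suc (upTo (suc (L (N / 2))))) ≡⟨ map-∘ (upTo (suc (L (N / 2)))) ⟨
  map ((N /2^_) ∘ suc) (upTo (suc (L (N / 2))))  ≡⟨ map-cong (/2^-suc N) (upTo (suc (L (N / 2)))) ⟩
  bounds (N / 2)                                 ∎
  where open ≡-Reasoning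

m+2j≡k? : ∀ m k → (∃[ j ] m + 2 * j ≡ k) ⊎ (∀ j → m + 2 * j ≢ k)
m+2j≡k? m k with m ≤? k
... | no m≰k = inj₂ (λ j m+2j≡k → m≰k (subst (m ≤_) m+2j≡k (m≤m+n m (2 * j))))
... | yes m≤k with n%2≡0⊎n%2≡1 (k ∸ m)
...   | inj₁ even = inj₁ ((k ∸ m) / 2 , trans (cong (_+_ m) (sym k∸m≡2j)) (m+[n∸m]≡n m≤k))
  where
  k∸m≡2j : k ∸ m ≡ 2 * ((k ∸ m) / 2)
  k∸m≡2j = trans (m≡m%n+[m/n]*n (k ∸ m) 2) (trans (cong (_+ (k ∸ m) / 2 * 2) even) (*-comm ((k ∸ m) / 2) 2))
...   | inj₂ odd  = inj₂ (λ j m+2j≡k → even≢odd j ((k ∸ m) / 2)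
                                     (trans (sym (trans (cong (_∸ m) (sym m+2j≡k)) (m+n∸m≡n m (2 * j)))) k∸m≡1+2j))
  where
  k∸m≡1+2j : k ∸ m ≡ suc (2 * ((k ∸ m) / 2))
  k∸m≡1+2j = trans (m≡m%n+[m/n]*n (k ∸ m) 2) (trans (cong (_+ (k ∸ m) / 2 * 2) odd) (cong suc (*-comm ((k ∸ m) / 2) 2)))

module _ where

  open Evaluation ℤ[ω]-commutativeSemiring
  open At ι (λ _ _ → refl) ι-* refl refl ω
  open FiniteSums ℤ[ω]-commutativeSemiring
  open import Algebra.Properties.Semiring.Exp (CommutativeSemiring.semiring ℤ[ω]-commutativeSemiring)
    using (^-homo-*) renaming (_^_ to _^ʳ_)

  -- By induction: if p = (1 + x + x²) q + r₀ + r₁x, then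
  -- a + xp = (1 + x + x²)(r₁ + xq) + (a - r₁) + (r₀ - r₁)x.  The remainder is the value at ω.
  divide-1+x+x² : ∀ p → ∃[ q ] ∃[ r₀ ] ∃[ r₁ ]
    (∀ k → coeff p k ≡ mul1+x+x² (coeff q) k ℤ.+ coeff (r₀ ∷ r₁ ∷ []) k) × evalAt p ≡ (r₀ , r₁)
  divide-1+x+x² []      = [] , + 0 , + 0 , (λ { zero → refl ; (suc zero) → refl ; (suc (suc k)) → refl }) , refl
  divide-1+x+x² (a ∷ p) with divide-1+x+x² p
  ... | q , r₀ , r₁ , p≡ , evalAt-p = r₁ ∷ q , a ℤ.- r₁ , r₀ ℤ.- r₁ , a∷p≡ , evalAt-a∷p
    where
    a∷p≡ : ∀ k → coeff (a ∷ p) k ≡ mul1+x+x² (coeff (r₁ ∷ q)) k ℤ.+ coeff (a ℤ.- r₁ ∷ r₀ ℤ.- r₁ ∷ []) k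
    a∷p≡ zero                = k₀ a r₁
      where
      k₀ : ∀ a r → a ≡ r ℤ.+ + 0 ℤ.+ + 0 ℤ.+ (a ℤ.- r)
      k₀ = solve-∀
    a∷p≡ (suc zero)          = trans (p≡ 0) (k₁ (coeff q 0) r₀ r₁)
      where
      k₁ : ∀ q₀ r₀ r₁ → q₀ ℤ.+ + 0 ℤ.+ + 0 ℤ.+ r₀ ≡ q₀ ℤ.+ r₁ ℤ.+ + 0 ℤ.+ (r₀ ℤ.- r₁)
      k₁ = solve-∀
    a∷p≡ (suc (suc zero))    = trans (p≡ 1) (k₂ (coeff q 1) (coeff q 0) r₁)
      where
      k₂ : ∀ q₁ q₀ r₁ → q₁ ℤ.+ q₀ ℤ.+ + 0 ℤ.+ r₁ ≡ q₁ ℤ.+ q₀ ℤ.+ r₁ ℤ.+ + 0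
      k₂ = solve-∀
    a∷p≡ (suc (suc (suc k))) = p≡ (suc (suc k))
    evalAt-a∷p : evalAt (a ∷ p) ≡ (a ℤ.- r₁ , r₀ ℤ.- r₁)
    evalAt-a∷p = trans (cong (λ v → ι a +ω ω *ω v) evalAt-p) (cong₂ _,_ (re a r₀ r₁) (im a r₀ r₁))
      where
      re : ∀ a r₀ r₁ → a ℤ.+ (+ 0 ℤ.* r₀ ℤ.- + 1 ℤ.* r₁) ≡ a ℤ.- r₁
      re = solve-∀
      im : ∀ a r₀ r₁ → + 0 ℤ.+ (+ 0 ℤ.* r₁ ℤ.+ + 1 ℤ.* r₀ ℤ.- + 1 ℤ.* r₁) ≡ r₀ ℤ.- r₁
      im = solve-∀

  1+x+x²∣ₚ : ∀ p → evalAt p ≡ 0ω → 1+x+x² ∣ₚ p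
  1+x+x²∣ₚ p p[ω]≡0 with divide-1+x+x² p
  ... | q , r₀ , r₁ , p≡ , p[ω]≡r = q , λ k → trans (p≡ k) (trans (cong (ℤ._+_ (mul1+x+x² (coeff q) k)) (no-remainder k))
                                                         (trans (ℤP.+-identityʳ _) (sym (coeff-1+x+x²-*ₚ q k))))
    where
    r≡0 : (r₀ , r₁) ≡ 0ω
    r≡0 = trans (sym p[ω]≡r) p[ω]≡0
    no-remainder : ∀ k → coeff (r₀ ∷ r₁ ∷ []) k ≡ + 0
    no-remainder zero          = cong proj₁ r≡0
    no-remainder (suc zero)    = cong proj₂ r≡0
    no-remainder (suc (suc k)) = refl

  ω^[2^t]≡ω^2^ : ∀ t → ω ^ʳ (2 ^ t) ≡ ω^2^ t
  ω^[2^t]≡ω^2^ zero    = refl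
  ω^[2^t]≡ω^2^ (suc t) = begin
    ω ^ʳ (2 ^ t + (2 ^ t + 0))      ≡⟨ cong (λ m → ω ^ʳ (2 ^ t + m)) (+-identityʳ (2 ^ t)) ⟩
    ω ^ʳ (2 ^ t + 2 ^ t)            ≡⟨ ^-homo-* ω (2 ^ t) (2 ^ t) ⟩
    ω ^ʳ (2 ^ t) *ω ω ^ʳ (2 ^ t)    ≡⟨ cong₂ _*ω_ (ω^[2^t]≡ω^2^ t) (ω^[2^t]≡ω^2^ t) ⟩
    ω^2^ t *ω ω^2^ t                ≡⟨ ω^2^-square t ⟩
    ω^2^ (suc t)                    ∎
    where open ≡-Reasoning

  -- hValue t N λ is h_{𝓑,λ} for 𝓑(N), evaluated at ω^(2^t).
  hValue : ℕ → ℕ → List ℕ → ℤ[ω]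
  hValue t N ms = ∏ (upTo (suc (L N))) (λ i → U (t + i) ^ʳ hExp N ms i)

  hTail : ℕ → ℕ → List ℕ → ℤ[ω]
  hTail t N ρ = ∏ (upTo (L N)) (λ j → U (t + suc j) ^ʳ (N /2^ suc j ∸ mult ρ j))

  Φ : ℕ → ℕ → ℕ → ℤ[ω]
  Φ t N k = ∑ (partitionsWithin (bounds N) k) (hValue t N)

  hValue-∷ : ∀ t N m ρ → hValue t N (m ∷ ρ) ≡ U t ^ʳ (N /2^ 0 ∸ m) *ω hTail t N ρ
  hValue-∷ t N m ρ = cong₂ _*ω_ (cong (λ s → U s ^ʳ (N /2^ 0 ∸ m)) (+-identityʳ t))
                                (∏-applyUpTo-suc (L N) (λ i → U (t + i) ^ʳ hExp N (m ∷ ρ) i))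

  hTail-half : ∀ t N → 2 ≤ N → ∀ ρ → hTail t N ρ ≡ hValue (suc t) (N / 2) ρ
  hTail-half t N 2≤N ρ = trans (cong (λ K → ∏ (upTo K) (λ j → U (t + suc j) ^ʳ (N /2^ suc j ∸ mult ρ j))) (L-half N 2≤N))
    (∏-cong (upTo (suc (L (N / 2)))) (λ j → cong₂ _^ʳ_ (cong U (+-suc t j)) (cong (_∸ mult ρ j) (/2^-suc N j))))

  Φ-peel : ∀ t N k →
    Φ t N k ≡ ∑ (upTo (suc (N /2^ 0))) (λ m → U t ^ʳ (N /2^ 0 ∸ m) *ω fiber (tailBounds N) k m (hTail t N))
  Φ-peel t N k = trans (∑-partitions-peel (N /2^ 0) (tailBounds N) k (hValue t N))
    (∑-cong (upTo (suc (N /2^ 0))) (λ m _ →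
      fiber-*ˡ (tailBounds N) k m (U t ^ʳ (N /2^ 0 ∸ m)) {hValue t N ∘ (m ∷_)} {hTail t N} (hValue-∷ t N m)))

  fiber-hTail : ∀ t N k m {j} → 2 ≤ N → m + 2 * j ≡ k → fiber (tailBounds N) k m (hTail t N) ≡ Φ (suc t) (N / 2) j
  fiber-hTail t N k m {j} 2≤N m+2j≡k = begin
    fiber (tailBounds N) k m (hTail t N)                        ≡⟨ fiber-≡ (tailBounds N) {k} {m} {j} (hTail t N) m+2j≡k ⟩
    ∑ (partitionsWithin (tailBounds N) j) (hTail t N)
      ≡⟨ cong (λ bs → ∑ (partitionsWithin bs j) (hTail t N)) (tailBounds-half N 2≤N) ⟩
    ∑ (partitionsWithin (bounds (N / 2)) j) (hTail t N)
      ≡⟨ ∑-cong (partitionsWithin (bounds (N / 2)) j) (λ ρ _ → hTail-half t N 2≤N ρ) ⟩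
    Φ (suc t) (N / 2) j                                         ∎
    where open ≡-Reasoning

  open CommutativeSemiring ℤ[ω]-commutativeSemiring using (zeroʳ; zeroˡ; distribʳ)
    renaming (*-assoc to *ω-assoc; *-comm to *ω-comm)

  Φ-0≡U*Φ-1 : ∀ t N → 1 ≤ N → Φ t N 0 ≡ U t *ω Φ t N 1
  Φ-0≡U*Φ-1 t N 1≤N = begin
    Φ t N 0                                   ≡⟨ trans (Φ-peel t N 0) (∑-upTo-single (suc N₀) (term 0) (s≤s z≤n) only-0) ⟩
    U t ^ʳ (N₀ ∸ 0) *ω fiber tail 0 0 (hTail t N) ≡⟨ cong (U t ^ʳ N₀ *ω_) (fiber-≡ tail {0} {0} {0} (hTail t N) refl) ⟩
    U t ^ʳ N₀ *ω ∑ (partitionsWithin tail 0) (hTail t N)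
      ≡⟨ cong (λ e → U t ^ʳ e *ω ∑ (partitionsWithin tail 0) (hTail t N)) N₀≡1+[N₀∸1] ⟩
    U t *ω U t ^ʳ (N₀ ∸ 1) *ω ∑ (partitionsWithin tail 0) (hTail t N)
      ≡⟨ *ω-assoc (U t) (U t ^ʳ (N₀ ∸ 1)) (∑ (partitionsWithin tail 0) (hTail t N)) ⟩
    U t *ω (U t ^ʳ (N₀ ∸ 1) *ω ∑ (partitionsWithin tail 0) (hTail t N))
      ≡⟨ cong (λ v → U t *ω (U t ^ʳ (N₀ ∸ 1) *ω v)) (fiber-≡ tail {1} {1} {0} (hTail t N) refl) ⟨
    U t *ω term 1 1
      ≡⟨ cong (U t *ω_) (trans (Φ-peel t N 1) (∑-upTo-single (suc N₀) (term 1) (s≤s 1≤N₀) only-1)) ⟨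
    U t *ω Φ t N 1                            ∎
    where
    open ≡-Reasoning
    N₀ = N /2^ 0
    tail = tailBounds N
    term : ℕ → ℕ → ℤ[ω]
    term k m = U t ^ʳ (N₀ ∸ m) *ω fiber tail k m (hTail t N)
    term-vanishes : ∀ k m → (∀ j → m + 2 * j ≢ k) → term k m ≡ 0ω
    term-vanishes k m none = trans (cong (U t ^ʳ (N₀ ∸ m) *ω_) (fiber-empty tail {k} {m} (hTail t N) none)) (zeroʳ (U t ^ʳ (N₀ ∸ m)))
    1≤N₀ : 1 ≤ N₀
    1≤N₀ = subst (1 ≤_) (sym (/2^-zero N)) 1≤N
    N₀≡1+[N₀∸1] : N₀ ≡ suc (N₀ ∸ 1)
    N₀≡1+[N₀∸1] = sym (trans (+-comm 1 (N₀ ∸ 1)) (m∸n+n≡m 1≤N₀))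
    only-0 : ∀ m → m < suc N₀ → m ≢ 0 → term 0 m ≡ 0ω
    only-0 zero    _ 0≢0 = ⊥-elim (0≢0 refl)
    only-0 (suc m) _ _   = term-vanishes 0 (suc m) (λ _ ())
    only-1 : ∀ m → m < suc N₀ → m ≢ 1 → term 1 m ≡ 0ω
    only-1 zero             _ _   = term-vanishes 1 0 (λ j 2j≡1 → even≢odd j 0 2j≡1)
    only-1 (suc zero)       _ 1≢1 = ⊥-elim (1≢1 refl)
    only-1 (suc (suc m))    _ _   = term-vanishes 1 (suc (suc m)) (λ _ ())

  -- Only the partitions with k or k - 2 parts 1 contribute, and U_t² + U_{t+1} = 0 makes them cancel.
  Φ-vanishes : ∀ N t k → 2 ≤ k → k ≤ N → Φ t N k ≡ 0ω
  Φ-vanishes = <-rec (λ N → ∀ t k → 2 ≤ k → k ≤ N → Φ t N k ≡ 0ω) vanish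
    where
    vanish : ∀ N → (∀ {M} → M < N → ∀ t k → 2 ≤ k → k ≤ M → Φ t M k ≡ 0ω) → ∀ t k → 2 ≤ k → k ≤ N → Φ t N k ≡ 0ω
    vanish N rec t (suc zero)       (s≤s ()) _
    vanish N rec t k@(suc (suc k′)) 2≤k      k≤N = begin
      Φ t N k                                     ≡⟨ Φ-peel t N k ⟩
      ∑ (upTo (suc N₀)) term                      ≡⟨ ∑-upTo-pair (suc N₀) term (s≤s k′≤N₀) (s≤s k≤N₀) k′≢k others ⟩
      term k′ +ω term k                           ≡⟨ cong₂ _+ω_ term-k′ term-k ⟩
      (U t *ω (U t *ω P)) *ω Φ₁ +ω P *ω (U (suc t) *ω Φ₁) ≡⟨ regroup (U t) (U (suc t)) P Φ₁ ⟩
      (U t *ω U t +ω U (suc t)) *ω (P *ω Φ₁)       ≡⟨ cong (_*ω (P *ω Φ₁)) (U-square t) ⟩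
      0ω *ω (P *ω Φ₁)                              ≡⟨ zeroˡ (P *ω Φ₁) ⟩
      0ω                                           ∎
      where
      open ≡-Reasoning
      N₀ = N /2^ 0
      M = N / 2
      2≤N = ≤-trans 2≤k k≤N
      M<N : M < N
      M<N = m/n<m N 2 {{>-nonZero (≤-trans (s≤s z≤n) 2≤N)}} (s≤s (s≤s z≤n))
      k≤N₀ : k ≤ N₀
      k≤N₀ = subst (k ≤_) (sym (/2^-zero N)) k≤N
      k′≤N₀ : k′ ≤ N₀
      k′≤N₀ = ≤-trans (m≤n+m k′ 2) k≤N₀
      k′≢k : k′ ≢ k
      k′≢k k′≡k = <-irrefl k′≡k (≤-trans (n≤1+n (suc k′)) ≤-refl)
      P = U t ^ʳ (N₀ ∸ k)
      Φ₁ = Φ (suc t) M 1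
      term : ℕ → ℤ[ω]
      term m = U t ^ʳ (N₀ ∸ m) *ω fiber (tailBounds N) k m (hTail t N)
      term-k : term k ≡ P *ω (U (suc t) *ω Φ₁)
      term-k = cong (P *ω_) (trans (fiber-hTail t N k k 2≤N (+-identityʳ k))
                                   (Φ-0≡U*Φ-1 (suc t) M (subst (_≤ M) ([2n]/2≡n 1) (/-monoˡ-≤ 2 2≤N))))
      term-k′ : term k′ ≡ (U t *ω (U t *ω P)) *ω Φ₁
      term-k′ = cong₂ _*ω_ (cong (U t ^ʳ_) (∸-two N₀ k′ k≤N₀)) (fiber-hTail t N k k′ 2≤N (+-comm k′ 2))
        where
        ∸-two : ∀ B k′ → suc (suc k′) ≤ B → B ∸ k′ ≡ suc (suc (B ∸ suc (suc k′)))
        ∸-two (suc (suc B)) zero     _         = refl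
        ∸-two (suc B)       (suc k′) (s≤s le) = ∸-two B k′ le
      others : ∀ m → m < suc N₀ → m ≢ k′ → m ≢ k → term m ≡ 0ω
      others m _ m≢k′ m≢k with m+2j≡k? m k
      ... | inj₂ none = trans (cong (U t ^ʳ (N₀ ∸ m) *ω_) (fiber-empty (tailBounds N) {k} {m} (hTail t N) none))
                              (zeroʳ (U t ^ʳ (N₀ ∸ m)))
      ... | inj₁ (j , m+2j≡k) = trans (cong (U t ^ʳ (N₀ ∸ m) *ω_) (trans (fiber-hTail t N k m 2≤N m+2j≡k)
                                  (rec M<N (suc t) j (2≤j j m+2j≡k) j≤M)))
                                      (zeroʳ (U t ^ʳ (N₀ ∸ m)))
        where
        2≤j : ∀ j → m + 2 * j ≡ k → 2 ≤ j
        2≤j zero             m+0≡k = ⊥-elim (m≢k (trans (sym (+-identityʳ m)) m+0≡k))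
        2≤j (suc zero)       m+2≡k = ⊥-elim (m≢k′ (suc-injective (suc-injective (trans (+-comm 2 m) m+2≡k))))
        2≤j (suc (suc _))    _     = s≤s (s≤s z≤n)
        j≤M : j ≤ M
        j≤M = subst (_≤ M) ([2n]/2≡n j) (/-monoˡ-≤ 2 (≤-trans (m≤n+m (2 * j) m) (subst (_≤ N) (sym m+2j≡k) k≤N)))
      regroup : ∀ u v p x → (u *ω (u *ω p)) *ω x +ω p *ω (v *ω x) ≡ (u *ω u +ω v) *ω (p *ω x)
      regroup u v p x = begin
        (u *ω (u *ω p)) *ω x +ω p *ω (v *ω x)
          ≡⟨ cong₂ _+ω_ (trans (cong (_*ω x) (sym (*ω-assoc u u p))) (*ω-assoc (u *ω u) p x))
                        (trans (sym (*ω-assoc p v x)) (trans (cong (_*ω x) (*ω-comm p v)) (*ω-assoc v p x))) ⟩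
        (u *ω u) *ω (p *ω x) +ω v *ω (p *ω x)
          ≡⟨ distribʳ (p *ω x) (u *ω u) v ⟨
        (u *ω u +ω v) *ω (p *ω x) ∎

  1+x+x²∣num𝓑 : ∀ n → 1 < n → 1+x+x² ∣ₚ num𝓑 n
  1+x+x²∣num𝓑 n 1<n = 1+x+x²∣ₚ (num𝓑 n) (begin
    evalAt (num𝓑 n)   ≡⟨ evalAt-num𝓑 n ⟩
    ∑ (𝓑 n) (λ ms → ∏ (upTo (suc (L n))) (λ i → (1ω +ω ω ^ʳ (2 ^ i)) ^ʳ hExp n ms i))
                      ≡⟨ ∑-cong (𝓑 n) (λ ms _ → ∏-cong (upTo (suc (L n)))
                           (λ i → cong (λ u → u ^ʳ hExp n ms i) (cong (1ω +ω_) (ω^[2^t]≡ω^2^ i)))) ⟩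
    Φ 0 n n           ≡⟨ Φ-vanishes n 0 n 1<n ≤-refl ⟩
    0ω                ∎)
    where open ≡-Reasoning

-- The coefficients of num𝓑

open FiniteSums ℤP.+-*-commutativeSemiring

coeff-∑ : ∀ {A : Set} (h : A → Poly) l k → coeff (foldr (λ y acc → h y +ₚ acc) [] l) k ≡ ∑ l (λ y → coeff (h y) k)
coeff-∑ h []      k = refl
coeff-∑ h (y ∷ l) k = trans (coeff-+ₚ (h y) _ k) (cong (ℤ._+_ (coeff (h y) k)) (coeff-∑ h l k))

b≡∑ : ∀ n k → b n k ≡ ∑ (𝓑 n) (λ ms → coeff (h𝓑 n ms) k)
b≡∑ n = coeff-∑ (h𝓑 n) (𝓑 n)

∑-nonneg : ∀ {A : Set} (l : List A) f → (∀ x → x ∈ l → + 0 ℤ.≤ f x) → + 0 ℤ.≤ ∑ l f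
∑-nonneg []      f f≥0 = ℤP.≤-refl
∑-nonneg (x ∷ l) f f≥0 = ℤP.+-mono-≤ (f≥0 x (here refl)) (∑-nonneg l f (λ y → f≥0 y ∘ there))

∑-≥-term : ∀ {A : Set} (l : List A) f → (∀ x → x ∈ l → + 0 ℤ.≤ f x) → ∀ {y} → y ∈ l → f y ℤ.≤ ∑ l f
∑-≥-term (x ∷ l) f f≥0 (here refl) =
  subst (ℤ._≤ f x ℤ.+ ∑ l f) (ℤP.+-identityʳ (f x)) (ℤP.+-monoʳ-≤ (f x) (∑-nonneg l f (λ y → f≥0 y ∘ there)))
∑-≥-term (x ∷ l) f f≥0 (there y∈l) =
  ℤP.≤-trans (∑-≥-term l f (λ y → f≥0 y ∘ there) y∈l)
             (subst (ℤ._≤ f x ℤ.+ ∑ l f) (ℤP.+-identityˡ (∑ l f)) (ℤP.+-monoˡ-≤ (∑ l f) (f≥0 x (here refl))))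

∑-cast : ∀ {A : Set} (l : List A) (f : A → ℕ) → ∑ l (λ x → + f x) ≡ + sum (map f l)
∑-cast []      f = refl
∑-cast (x ∷ l) f = cong (ℤ._+_ (+ f x)) (∑-cast l f)

∑-one : ∀ {A : Set} (l : List A) → ∑ l (λ _ → + 1) ≡ + length l
∑-one []      = refl
∑-one (x ∷ l) = cong (ℤ._+_ (+ 1)) (∑-one l)

h𝓑-deg : ∀ n {ms} → ms ∈ 𝓑 n → prodDeg (hExp n ms) (upTo (suc (L n))) ≡ numDeg n
h𝓑-deg n {ms} ms∈𝓑 with ∈𝓑⁻ ms∈𝓑
... | weight≡n , ms≤bounds = begin
  prodDeg (hExp n ms) l                                ≡⟨ m+n∸n≡m _ n ⟨
  prodDeg (hExp n ms) l + n ∸ n                        ≡⟨ cong (λ w → prodDeg (hExp n ms) l + w ∸ n) weight ⟨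
  prodDeg (hExp n ms) l + prodDeg (mult ms) l ∸ n      ≡⟨ cong (_∸ n) (prodDeg-∸ (n /2^_) (mult ms) l mult≤) ⟩
  numDeg n                                             ∎
  where
  open ≡-Reasoning
  l = upTo (suc (L n))
  length≡ : length ms ≡ suc (L n)
  length≡ = trans (Pointwise-length ms≤bounds) (trans (length-map (n /2^_) l) (length-upTo (suc (L n))))
  weight : prodDeg (mult ms) l ≡ n
  weight = trans (prodDeg-mult ms (suc (L n)) (≤-reflexive length≡)) weight≡n
  mult≤ : All (λ i → mult ms i ≤ n /2^ i) l
  mult≤ = applyUpTo⁺₁ id (suc (L n)) (λ {i} i<K → subst (mult ms i ≤_)
            (trans (cong (λ bs → mult bs i) (map-upTo (n /2^_) (suc (L n)))) (mult-applyUpTo (n /2^_) (suc (L n)) i i<K))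
            (mult-≤ ms≤bounds i))

h𝓑-shape : ∀ n {ms} → ms ∈ 𝓑 n → ProductShape (numDeg n) (coeff (h𝓑 n ms))
h𝓑-shape n {ms} ms∈𝓑 =
  subst (λ D → ProductShape D (coeff (h𝓑 n ms))) (h𝓑-deg n ms∈𝓑) (prodₚ-shape (hExp n ms) (upTo (suc (L n))))

h𝓑≤b : ∀ n {ms} k → ms ∈ 𝓑 n → coeff (h𝓑 n ms) k ℤ.≤ b n k
h𝓑≤b n {ms} k ms∈𝓑 =
  subst (coeff (h𝓑 n ms) k ℤ.≤_) (sym (b≡∑ n k)) (∑-≥-term (𝓑 n) _ (λ ms ms∈ → nonneg (h𝓑-shape n ms∈) k) ms∈𝓑)

b-vanishes : ∀ n k → numDeg n < k → b n k ≡ + 0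
b-vanishes n k D<k = trans (b≡∑ n k) (∑-zero (𝓑 n) (λ ms ms∈ → vanishes (h𝓑-shape n ms∈) k D<k))

b-palindrome : ∀ n i j → i + j ≡ numDeg n → b n i ≡ b n j
b-palindrome n i j i+j≡D =
  trans (b≡∑ n i) (trans (∑-cong (𝓑 n) (λ ms ms∈ → palindrome (h𝓑-shape n ms∈) i j i+j≡D)) (sym (b≡∑ n j)))

allOnes : ℕ → List ℕ
allOnes n = n ∷ replicate (L n) 0

allOnes∈𝓑 : ∀ n → allOnes n ∈ 𝓑 n
allOnes∈𝓑 n = ∈𝓑⁺ weight (≤-reflexive (sym (/2^-zero n)) ∷ zeros≤ (L n) (n /2^_) suc)
  where
  weight : weightFrom 0 (allOnes n) ≡ n
  weight = trans (cong (_+_ (n * 1)) (weightFrom-zeros 1 (L n))) (trans (+-identityʳ (n * 1)) (*-identityʳ n))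

b-top : ∀ n → + 0 ℤ.< b n (numDeg n)
b-top n = ℤP.<-≤-trans (top (h𝓑-shape n (allOnes∈𝓑 n))) (h𝓑≤b n (numDeg n) (allOnes∈𝓑 n))

deg-≡ : ∀ p D → coeff p D ≢ + 0 → (∀ k → D < k → coeff p k ≡ + 0) → deg p ≡ D
deg-≡ p D p_D≢0 vanish = cong (_∸ 1) (trimLen≡ p D p_D≢0 vanish)
  where
  trimLen≡0 : ∀ p → (∀ k → coeff p k ≡ + 0) → trimLen p ≡ 0
  trimLen≡0 []      _    = refl
  trimLen≡0 (a ∷ p) all0 with trimLen p | trimLen≡0 p (all0 ∘ suc)
  ... | zero | _ with a ℤ.≟ + 0
  ...   | yes _   = refl
  ...   | no  a≢0 = ⊥-elim (a≢0 (all0 0))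
  trimLen≡ : ∀ p D → coeff p D ≢ + 0 → (∀ k → D < k → coeff p k ≡ + 0) → trimLen p ≡ suc D
  trimLen≡ []      D       p_D≢0 _      = ⊥-elim (p_D≢0 refl)
  trimLen≡ (a ∷ p) zero    a≢0   vanish with trimLen p | trimLen≡0 p (λ k → vanish (suc k) (s≤s z≤n))
  ... | zero | _ with a ℤ.≟ + 0
  ...   | yes a≡0 = ⊥-elim (a≢0 a≡0)
  ...   | no  _   = refl
  trimLen≡ (a ∷ p) (suc D) p_D≢0 vanish with trimLen p | trimLen≡ p D p_D≢0 (λ k → vanish (suc k) ∘ s≤s)
  ... | suc _ | refl = refl

d≡numDeg : ∀ n → d n ≡ numDeg n
d≡numDeg n = deg-≡ (num𝓑 n) (numDeg n) (λ b≡0 → ℤP.<-irrefl (sym b≡0) (b-top n)) (b-vanishes n)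

Palindromic-intro : ∀ p D → deg p ≡ D → (∀ i j → i + j ≡ D → coeff p i ≡ coeff p j) → Palindromic p
Palindromic-intro p D refl palindrome k k≤D = palindrome k (deg p ∸ k) (m+[n∸m]≡n k≤D)

num-palindromic : ∀ n → Palindromic (num𝓑 n)
num-palindromic n = Palindromic-intro (num𝓑 n) (numDeg n) (d≡numDeg n) (b-palindrome n)

den-palindromic : ∀ n → Palindromic (den𝓑 n)
den-palindromic n = Palindromic-intro (den𝓑 n) _ (deg-≡ (den𝓑 n) _ (λ c≡0 → ℤP.<-irrefl (sym c≡0) (top S)) (vanishes S))
                                      (palindrome S)
  where S = prodₚ-shape (n /2^_) (upTo (suc (L n)))

mostlyTwos : ℕ → List ℕ
mostlyTwos n = n % 2 ∷ n / 2 ∷ replicate (L n ∸ 1) 0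

mostlyTwos∈𝓑 : ∀ n → 2 ≤ n → mostlyTwos n ∈ 𝓑 n
mostlyTwos∈𝓑 n 2≤n = ∈𝓑⁺ weight bounded
  where
  weight : weightFrom 0 (mostlyTwos n) ≡ n
  weight = begin
    n % 2 * 1 + (n / 2 * 2 + weightFrom 2 (replicate (L n ∸ 1) 0))
      ≡⟨ cong₂ _+_ (*-identityʳ (n % 2)) (cong (_+_ (n / 2 * 2)) (weightFrom-zeros 2 (L n ∸ 1))) ⟩
    n % 2 + (n / 2 * 2 + 0)
      ≡⟨ cong (_+_ (n % 2)) (+-identityʳ (n / 2 * 2)) ⟩
    n % 2 + n / 2 * 2
      ≡⟨ m≡m%n+[m/n]*n n 2 ⟨
    n ∎
    where open ≡-Reasoning
  bounded : Pointwise _≤_ (mostlyTwos n) (bounds n)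
  bounded rewrite L-half n 2≤n =
    ≤-trans (m%n≤m n 2) (≤-reflexive (sym (/2^-zero n))) ∷ ≤-refl ∷ zeros≤ (L (n / 2)) (n /2^_) (suc ∘ suc)

b₀-positive : ∀ n → + 0 ℤ.< b n 0
b₀-positive n = ℤP.<-≤-trans (subst (+ 0 ℤ.<_) (sym (constant (h𝓑-shape n (allOnes∈𝓑 n)))) (ℤ.+<+ (s≤s z≤n)))
                             (h𝓑≤b n 0 (allOnes∈𝓑 n))

-- For λ = mostlyTwos n the factors (1 + x^(2^i)), i ≥ 1, leave gaps of at most 2^(L n) between positive
-- coefficients, and the factor (1 + x)^(n - n mod 2) closes all of them.
b-positive : ∀ n → 1 ≤ n → ∀ k → k ≤ numDeg n → + 0 ℤ.< b n k
b-positive n 1≤n k k≤D with n ≟ 1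
... | yes refl = subst (λ j → + 0 ℤ.< b 1 j) (sym (n≤0⇒n≡0 k≤D)) (b₀-positive 1)
... | no n≢1 = ℤP.<-≤-trans positive-at-k (h𝓑≤b n k λ∈𝓑)
  where
  2≤n : 2 ≤ n
  2≤n = ≤∧≢⇒< 1≤n (n≢1 ∘ sym)
  λ∈𝓑 = mostlyTwos∈𝓑 n 2≤n
  e = hExp n (mostlyTwos n)
  tail = applyUpTo suc (L n)
  2^L≤e₀+1 : 2 ^ L n ≤ e 0 + 1
  2^L≤e₀+1 = begin
    2 ^ L n                   ≤⟨ proj₁ (L-bounds n 1≤n) ⟩
    n                         ≡⟨ m∸n+n≡m (m%n≤m n 2) ⟨
    n ∸ n % 2 + n % 2         ≤⟨ +-monoʳ-≤ (n ∸ n % 2) (s≤s⁻¹ (m%n<n n 2)) ⟩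
    n ∸ n % 2 + 1             ≡⟨ cong (λ m → m ∸ n % 2 + 1) (/2^-zero n) ⟨
    e 0 + 1                   ∎
    where open ≤-Reasoning
  everywhere : PositiveInWindows 1 (e 0 * 1 + prodDeg e tail) (mulPow1+x^ 1 (e 0) (coeff (prodₚ e tail)))
  everywhere = mulPow1+x-windows ≤-refl (e 0) (prodₚ-shape e tail)
                 (PositiveInWindows-mono 2^L≤e₀+1 (prodₚ-windows e tail (applyUpTo⁺₁ suc (L n) id)))
  positive-at-k : + 0 ℤ.< coeff (h𝓑 n (mostlyTwos n)) k
  positive-at-k with everywhere k (subst (k ≤_) (sym (h𝓑-deg n λ∈𝓑)) k≤D)
  ... | t , t≤k , k<t+1 , positive =
    subst (+ 0 ℤ.<_) (sym (coeff-prodₚ-∷ e 0 tail k))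
      (subst (λ j → + 0 ℤ.< mulPow1+x^ 1 (e 0) (coeff (prodₚ e tail)) j)
             (≤-antisym t≤k (s≤s⁻¹ (subst (suc k ≤_) (+-comm t 1) k<t+1))) positive)

b₀≡B : ∀ n → b n 0 ≡ + B n
b₀≡B n = trans (b≡∑ n 0) (trans (∑-cong (𝓑 n) (λ ms _ → prodₚ-coeff₀ (hExp n ms) (upTo (suc (L n))))) (∑-one (𝓑 n)))

b₁≡ : ∀ n → b n 1 ≡ + sum (map (λ lam → n ∸ mult lam 0) (𝓑 n))
b₁≡ n = trans (b≡∑ n 1) (trans (∑-cong (𝓑 n) coeff₁) (∑-cast (𝓑 n) (λ lam → n ∸ mult lam 0)))
  where
  coeff₁ : ∀ ms → ms ∈ 𝓑 n → coeff (h𝓑 n ms) 1 ≡ + (n ∸ mult ms 0)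
  coeff₁ ms _ = trans (prodₚ-coeff₁ (hExp n ms) (L n)) (cong (λ m → + (m ∸ mult ms 0)) (/2^-zero n))

b₂≡ : ∀ n → 1 ≤ n → b n 2 ≡ + sum (map (λ lam → (n ∸ mult lam 0) C 2 + (n / 2 ∸ mult lam 1)) (𝓑 n))
b₂≡ n 1≤n with n ≟ 1
... | yes refl = refl
... | no n≢1 = trans (b≡∑ n 2) (trans (∑-cong (𝓑 n) coeff₂) (∑-cast (𝓑 n) _))
  where
  coeff₂ : ∀ ms → ms ∈ 𝓑 n → coeff (h𝓑 n ms) 2 ≡ + ((n ∸ mult ms 0) C 2 + (n / 2 ∸ mult ms 1))
  coeff₂ ms _ = begin
    coeff (prodₚ (hExp n ms) (upTo (suc (L n)))) 2
      ≡⟨ cong (λ K → coeff (prodₚ (hExp n ms) (upTo (suc K))) 2) (L-half n (≤∧≢⇒< 1≤n (n≢1 ∘ sym))) ⟩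
    coeff (prodₚ (hExp n ms) (upTo (suc (suc (L (n / 2)))))) 2
      ≡⟨ prodₚ-coeff₂ (hExp n ms) (L (n / 2)) ⟩
    + ((n /2^ 0 ∸ mult ms 0) C 2 + (n / 2 ∸ mult ms 1))
      ≡⟨ cong (λ m → + ((m ∸ mult ms 0) C 2 + (n / 2 ∸ mult ms 1))) (/2^-zero n) ⟩
    + ((n ∸ mult ms 0) C 2 + (n / 2 ∸ mult ms 1)) ∎
    where open ≡-Reasoning

-- Adding one part 1 is a bijection 𝓑(2n) → 𝓑(2n+1) that preserves h (the number of parts 1 of a
-- partition of 2n+1 is odd, hence nonzero).
b-odd≡b-even : ∀ n → 1 ≤ n → ∀ k → b (2 * n + 1) k ≡ b (2 * n) k
b-odd≡b-even n 1≤n k = begin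
  b M k
    ≡⟨ trans (b≡∑ M k) (∑-partitions-peel (M /2^ 0) (tailBounds M) M fM) ⟩
  ∑ (upTo (suc (M /2^ 0))) (λ m → fiber (tailBounds M) M m (fM ∘ (m ∷_)))
    ≡⟨ cong (λ c → ∑ (upTo (suc c)) (λ m → fiber (tailBounds M) M m (fM ∘ (m ∷_)))) M₀≡1+N₀ ⟩
  ∑ (upTo (suc (suc N₀))) (λ m → fiber (tailBounds M) M m (fM ∘ (m ∷_)))
    ≡⟨ ∑-upTo-suc (suc N₀) (λ m → fiber (tailBounds M) M m (fM ∘ (m ∷_))) ⟩
  fiber (tailBounds M) M 0 (fM ∘ (0 ∷_)) ℤ.+ ∑ (upTo (suc N₀)) (λ m → fiber (tailBounds M) M (suc m) (fM ∘ (suc m ∷_)))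
    ≡⟨ cong₂ ℤ._+_ (fiber-empty (tailBounds M) {M} {0} (fM ∘ (0 ∷_)) (λ j 2j≡M → even≢odd j n (trans 2j≡M (+-comm (2 * n) 1))))
                   (∑-cong (upTo (suc N₀)) (λ m _ → add-one m)) ⟩
  + 0 ℤ.+ ∑ (upTo (suc N₀)) (λ m → fiber (tailBounds N) N m (fN ∘ (m ∷_)))
    ≡⟨ ℤP.+-identityˡ _ ⟩
  ∑ (upTo (suc N₀)) (λ m → fiber (tailBounds N) N m (fN ∘ (m ∷_)))
    ≡⟨ trans (b≡∑ N k) (∑-partitions-peel N₀ (tailBounds N) N fN) ⟨
  b N k ∎
  where
  open ≡-Reasoning
  M = 2 * n + 1
  N = 2 * n
  N₀ = N /2^ 0
  fM = λ ms → coeff (h𝓑 M ms) k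
  fN = λ ms → coeff (h𝓑 N ms) k
  M₀≡1+N₀ : M /2^ 0 ≡ suc N₀
  M₀≡1+N₀ = trans (/2^-zero M) (trans (+-comm N 1) (cong suc (sym (/2^-zero N))))
  LM≡LN : L M ≡ L N
  LM≡LN = L-[2n+1]≡L-[2n] n 1≤n
  tails≡ : tailBounds M ≡ tailBounds N
  tails≡ = trans (cong (λ K → map (M /2^_) (applyUpTo suc K)) LM≡LN)
                 (map-cong-local (applyUpTo⁺₂ suc (L N) ([2n+1]/2^[1+i]≡[2n]/2^[1+i] n)))
  h≡ : ∀ m ρ → h𝓑 M (suc m ∷ ρ) ≡ h𝓑 N (m ∷ ρ)
  h≡ m ρ = trans (cong (λ K → prodₚ (hExp M (suc m ∷ ρ)) (upTo (suc K))) LM≡LN) (prodₚ-cong exponents (upTo (suc (L N))))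
    where
    exponents : ∀ i → hExp M (suc m ∷ ρ) i ≡ hExp N (m ∷ ρ) i
    exponents zero    = cong (_∸ suc m) M₀≡1+N₀
    exponents (suc j) = cong (_∸ mult ρ j) ([2n+1]/2^[1+i]≡[2n]/2^[1+i] n j)
  add-one : ∀ m → fiber (tailBounds M) M (suc m) (fM ∘ (suc m ∷_)) ≡ fiber (tailBounds N) N m (fN ∘ (m ∷_))
  add-one m = trans (cong (λ t → fiber t M (suc m) (fM ∘ (suc m ∷_))) tails≡)
    (∑-cong (boxes (tailBounds N)) (λ ρ _ → cong₂ when
      (does-⇔ (suc m + 2 * weightFrom 0 ρ ≟ M) (m + 2 * weightFrom 0 ρ ≟ N)
              (λ eq → suc-injective (trans eq (+-comm N 1))) (λ eq → trans (cong suc eq) (+-comm 1 N)))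
      (cong (λ p → coeff p k) (h≡ m ρ))))

module _ where

  open Evaluation ℤP.+-*-commutativeSemiring
  open At id (λ _ _ → refl) (λ _ _ → refl) refl refl -[1+ 0 ]
  open import Algebra.Properties.Semiring.Exp ℤP.+-*-semiring using (^-homo-*) renaming (_^_ to _^ʳ_)

  [-1]^a*[-1]^a≡1 : ∀ a → -[1+ 0 ] ^ʳ a ℤ.* -[1+ 0 ] ^ʳ a ≡ + 1
  [-1]^a*[-1]^a≡1 zero    = refl
  [-1]^a*[-1]^a≡1 (suc a) = trans (regroup (-[1+ 0 ] ^ʳ a)) ([-1]^a*[-1]^a≡1 a)
    where
    regroup : ∀ p → (-[1+ 0 ] ℤ.* p) ℤ.* (-[1+ 0 ] ℤ.* p) ≡ p ℤ.* p
    regroup = solve-∀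

  1+[-1]^2^[1+i]≡2 : ∀ i → + 1 ℤ.+ -[1+ 0 ] ^ʳ (2 ^ suc i) ≡ + 2
  1+[-1]^2^[1+i]≡2 i = cong (ℤ._+_ (+ 1)) (begin
    -[1+ 0 ] ^ʳ (2 ^ i + (2 ^ i + 0))       ≡⟨ cong (λ m → -[1+ 0 ] ^ʳ (2 ^ i + m)) (+-identityʳ (2 ^ i)) ⟩
    -[1+ 0 ] ^ʳ (2 ^ i + 2 ^ i)             ≡⟨ ^-homo-* -[1+ 0 ] (2 ^ i) (2 ^ i) ⟩
    -[1+ 0 ] ^ʳ (2 ^ i) ℤ.* -[1+ 0 ] ^ʳ (2 ^ i) ≡⟨ [-1]^a*[-1]^a≡1 (2 ^ i) ⟩
    + 1                                     ∎)
    where open ≡-Reasoning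

  +2^ʳ≡+2^ : ∀ m → (+ 2) ^ʳ m ≡ + (2 ^ m)
  +2^ʳ≡+2^ zero    = refl
  +2^ʳ≡+2^ (suc m) = trans (cong (ℤ._*_ (+ 2)) (+2^ʳ≡+2^ m)) (sym (ℤP.pos-* 2 (2 ^ m)))

  ∏-higher-factors-at-−1 : ∀ e (f : ℕ → ℕ) K →
    ∏ (applyUpTo (suc ∘ f) K) (λ i → (+ 1 ℤ.+ -[1+ 0 ] ^ʳ (2 ^ i)) ^ʳ e i) ≡ + (2 ^ sumBelow K (e ∘ suc ∘ f))
  ∏-higher-factors-at-−1 e f zero    = refl
  ∏-higher-factors-at-−1 e f (suc K) = begin
    (+ 1 ℤ.+ -[1+ 0 ] ^ʳ (2 ^ suc (f 0))) ^ʳ e (suc (f 0)) ℤ.*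
      ∏ (applyUpTo (suc ∘ f ∘ suc) K) (λ i → (+ 1 ℤ.+ -[1+ 0 ] ^ʳ (2 ^ i)) ^ʳ e i)
      ≡⟨ cong₂ (λ b p → b ^ʳ e (suc (f 0)) ℤ.* p) (1+[-1]^2^[1+i]≡2 (f 0)) (∏-higher-factors-at-−1 e (f ∘ suc) K) ⟩
    (+ 2) ^ʳ e (suc (f 0)) ℤ.* + (2 ^ sumBelow K (e ∘ suc ∘ f ∘ suc))
      ≡⟨ cong (ℤ._* + (2 ^ sumBelow K (e ∘ suc ∘ f ∘ suc))) (+2^ʳ≡+2^ (e (suc (f 0)))) ⟩
    + (2 ^ e (suc (f 0))) ℤ.* + (2 ^ sumBelow K (e ∘ suc ∘ f ∘ suc))
      ≡⟨ ℤP.pos-* (2 ^ e (suc (f 0))) _ ⟨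
    + (2 ^ e (suc (f 0)) * 2 ^ sumBelow K (e ∘ suc ∘ f ∘ suc))
      ≡⟨ cong +_ (^-distribˡ-+-* 2 (e (suc (f 0))) _) ⟨
    + (2 ^ sumBelow (suc K) (e ∘ suc ∘ f)) ∎
    where open ≡-Reasoning

  -- At x = -1 the factor (1 + x)^(n - m_λ(1)) kills every term except λ = (n, 0, …, 0), whose
  -- remaining factors are all (1 + 1)^⌊n/2^i⌋; Legendre's formula finishes the computation.
  eval-num𝓑-at-−1 : ∀ n → eval (num𝓑 n) -[1+ 0 ] ≡ + (2 ^ val₂ (n !))
  eval-num𝓑-at-−1 n = begin
    eval (num𝓑 n) -[1+ 0 ]
      ≡⟨ evalAt-num𝓑 n ⟩
    ∑ (𝓑 n) value
      ≡⟨ ∑-partitions-peel n₀ (tailBounds n) n value ⟩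
    ∑ (upTo (suc n₀)) (λ m → fiber (tailBounds n) n m (value ∘ (m ∷_)))
      ≡⟨ ∑-upTo-single (suc n₀) (λ m → fiber (tailBounds n) n m (value ∘ (m ∷_))) ≤-refl
           (λ m m<1+n₀ m≢n₀ → fiber-zero (tailBounds n) n m (value-vanishes (≤∧≢⇒< (s≤s⁻¹ m<1+n₀) m≢n₀))) ⟩
    fiber (tailBounds n) n n₀ (value ∘ (n₀ ∷_))
      ≡⟨ fiber-≡ (tailBounds n) (value ∘ (n₀ ∷_)) (trans (+-identityʳ n₀) (/2^-zero n)) ⟩
    ∑ (partitionsWithin (tailBounds n) 0) (value ∘ (n₀ ∷_))
      ≡⟨ ∑-partitions-of-0 (tailBounds n) (value ∘ (n₀ ∷_)) ⟩
    value (n₀ ∷ zeros)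
      ≡⟨ cong (λ t → (+ 0) ^ʳ t ℤ.* ∏ (applyUpTo suc (L n)) (factor (n₀ ∷ zeros))) (n∸n≡0 n₀) ⟩
    + 1 ℤ.* ∏ (applyUpTo suc (L n)) (factor (n₀ ∷ zeros))
      ≡⟨ ℤP.*-identityˡ _ ⟩
    ∏ (applyUpTo suc (L n)) (factor (n₀ ∷ zeros))
      ≡⟨ ∏-higher-factors-at-−1 (hExp n (n₀ ∷ zeros)) id (L n) ⟩
    + (2 ^ sumBelow (L n) (λ j → n /2^ suc j ∸ mult zeros j))
      ≡⟨ cong (λ v → + (2 ^ v)) (sumBelow-cong (L n) (λ j _ → cong (n /2^ suc j ∸_) (mult-zeros (length (tailBounds n)) j))) ⟩
    + (2 ^ legendre₂ n)
      ≡⟨ cong (λ v → + (2 ^ v)) (val₂-! n) ⟨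
    + (2 ^ val₂ (n !)) ∎
    where
    open ≡-Reasoning
    n₀ = n /2^ 0
    zeros = replicate (length (tailBounds n)) 0
    factor : List ℕ → ℕ → ℤ
    factor ms i = (+ 1 ℤ.+ -[1+ 0 ] ^ʳ (2 ^ i)) ^ʳ hExp n ms i
    value : List ℕ → ℤ
    value ms = ∏ (upTo (suc (L n))) (factor ms)
    value-vanishes : ∀ {m} → m < n₀ → ∀ ρ → value (m ∷ ρ) ≡ + 0
    value-vanishes {m} m<n₀ ρ with n₀ ∸ m | m<n⇒0<n∸m m<n₀
    ... | suc _ | _ = refl

proposition4p3 : (n : ℕ) → 1 ≤ n →
      -- (a)
      (∀ k → b (2 * n + 1) k ≡ b (2 * n) k)
      -- (b)  (terms with j > n vanish)
    × (d n ≡ sumRange 1 n (λ j → 2 ^ j * (n /2^ j)))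
      -- (c)
    × (2 ∣ d n)
    × (2 ^ L n * L n ≤ d n)
    × (d n ≤ n * L n)
    × (d n + sumRange (val₂ n + 1) (L n) (λ j → n %2^ j) ≡ n * L n)
      -- (d)
    × (∀ k → k ≤ d n → + 0 ℤ.< b n k)
      -- (e)
    × Palindromic (num𝓑 n)
    × Palindromic (den𝓑 n)
      -- (f)
    × (b n 0 ≡ + B n)
    × (b n 1 ≡ + sum (map (λ lam → n ∸ mult lam 0) (𝓑 n)))
    × (b n 2 ≡ + sum (map (λ lam → (n ∸ mult lam 0) C 2 + (n / 2 ∸ mult lam 1)) (𝓑 n)))
      -- (g)
    × (eval (num𝓑 n) -[1+ 0 ] ≡ + (2 ^ val₂ (n !)))
      -- (h)
    × (1 < n → (+ 1 ∷ + 1 ∷ + 1 ∷ []) ∣ₚ num𝓑 n)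
proposition4p3 n 1≤n =
  b-odd≡b-even n 1≤n ,
  trans d≡D (numDeg≡sumRange n 1≤n) ,
  subst (2 ∣_) (sym d≡D) (numDeg-even n) ,
  subst (2 ^ L n * L n ≤_) (sym d≡D) (numDeg-lower n 1≤n) ,
  subst (_≤ n * L n) (sym d≡D) (numDeg-upper n) ,
  subst (λ D → D + sumRange (val₂ n + 1) (L n) (n %2^_) ≡ n * L n) (sym d≡D) (numDeg+remainders n 1≤n) ,
  (λ k k≤d → b-positive n 1≤n k (subst (k ≤_) d≡D k≤d)) ,
  num-palindromic n ,
  den-palindromic n ,
  b₀≡B n ,
  b₁≡ n ,
  b₂≡ n 1≤n ,
  eval-num𝓑-at-−1 n ,
  1+x+x²∣num𝓑 n
  where
  d≡D : d n ≡ numDeg n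
  d≡D = d≡numDeg n
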